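{- Consider a functional pure type system specification $(\mathcal S,\mathcal A,\mathcal R)$, its explicitly-typed pure type system (EPTS) and its Dedukti encoding $(\Sigma_{EPTS},\mathscr R_{EPTS})$ with translation $[\![-]\!]$. Let $\Gamma$ be an EPTS context and $M,A$ EPTS terms. (1) If $\Gamma$ is well-formed then $[\![\Gamma]\!]$ is well-formed in Dedukti (in signature $\Sigma_{EPTS}$). (2) If $\Gamma\vdash M:A$, then: if $A$ is a top-sort, $[\![\Gamma]\!]\vdash_{DK}[\![M]\!]:\mathbf U_A$; otherwise $[\![\Gamma]\!]\vdash_{DK}[\![M]\!]:\mathbf{El}_{s_A}\,[\![A]\!]$, where $s_A$ is the sort with $\Gamma\vdash A:s_A$.
   Context: A functional PTS specification consists of a set of sorts $\mathcal S$, $\mathcal A\subseteq\mathcal S^2$ and $\mathcal R\subseteq\mathcal S^3$, with $\mathcal A$ functional and $\mathcal R$ functional in its first two components. A sort $s$ is a top-sort if there is no $s'$ with $(s,s')\in\mathcal A$. EPTS terms: $M::=x\mid s\mid\Pi_{s_1,s_2}(A,x.B)\mid\lambda_{s_1,s_2}(A,x.B,x.M)\mid @_{s_1,s_2}(A,x.B,M,N)$ ($x$ bound in $B$ and in the body $M$). EPTS reduction is the context closure of $@_{s_1,s_2}(A,x.B,\lambda_{s_1,s_2}(A',x.B',x.M),N)\hookrightarrow M\{N/x\}$ for $(s_1,s_2,s_3)\in\mathcal R$, and $\equiv$ the generated equivalence. EPTS typing: $-$ is well-formed; if $\Gamma\vdash A:s$ and $x\notin\Gamma$ then $\Gamma,x:A$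 is well-formed; (Conv) $\Gamma\vdash M:A$, $\Gamma\vdash B:s$, $A\equiv B$ give $\Gamma\vdash M:B$; (Sort) $\Gamma$ well-formed and $(s_1,s_2)\in\mathcal A$ give $\Gamma\vdash s_1:s_2$; (Var) $\Gamma$ well-formed and $x:A\in\Gamma$ give $\Gamma\vdash x:A$; for $(s_1,s_2,s_3)\in\mathcal R$: (Prod) $\Gamma\vdash A:s_1$, $\Gamma,x:A\vdash B:s_2$ give $\Gamma\vdash\Pi_{s_1,s_2}(A,x.B):s_3$; (Abs) additionally $\Gamma,x:A\vdash M:B$ gives $\Gamma\vdash\lambda_{s_1,s_2}(A,x.B,x.M):\Pi_{s_1,s_2}(A,x.B)$; (App) $\Gamma\vdash A:s_1$, $\Gamma,x:A\vdash B:s_2$, $\Gamma\vdash N:A$, $\Gamma\vdash M:\Pi_{s_1,s_2}(A,x.B)$ give $\Gamma\vdash @_{s_1,s_2}(A,x.B,M,N):B\{N/x\}$. Since the system is functional, the sort of a type in a context is unique. Dedukti: terms $x\mid c[\vec M]\mid\mathtt{TYPE}\mid\mathtt{KIND}\mid MN\mid\lambda x:A.M\mid\Pi x:A.B$ with constants of fixed arity (written $c\,\vec M$); typing is the $\lambda\Pi$-calculus with constants declared $c[\Delta]:A$ in a signature and typed by $\Sigma;\Gamma\vdash c[\vec M]:A\{\vec M\}$ when $\vec M$ instantiates $\Delta$, with conversion modulo $\beta$ and the rewrite rules. The theory $(\Sigma_{EPTS},\mathscr R_{EPTS})$: for $s\in\mathcal S$, $\mathbf U_s:\mathtt{TYPE}$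 and $\mathbf{El}_s[A:\mathbf U_s]:\mathtt{TYPE}$; for $(s_1,s_2)\in\mathcal A$, $\mathbf u_{s_1}:\mathbf U_{s_2}$ and the rule $\mathbf{El}_{s_2}\,\mathbf u_{s_1}\hookrightarrow\mathbf U_{s_1}$; for $(s_1,s_2,s_3)\in\mathcal R$: $\mathbf{Prod}_{s_1,s_2}[A:\mathbf U_{s_1};B:\mathbf{El}_{s_1}A\to\mathbf U_{s_2}]:\mathbf U_{s_3}$, $\mathbf{abs}_{s_1,s_2}[A:\mathbf U_{s_1};B:\mathbf{El}_{s_1}A\to\mathbf U_{s_2};M:\Pi x:\mathbf{El}_{s_1}A.\mathbf{El}_{s_2}(B\,x)]:\mathbf{El}_{s_3}(\mathbf{Prod}_{s_1,s_2}A\,B)$, $\mathbf{app}_{s_1,s_2}[A:\mathbf U_{s_1};B:\mathbf{El}_{s_1}A\to\mathbf U_{s_2};M:\mathbf{El}_{s_3}(\mathbf{Prod}_{s_1,s_2}A\,B);N:\mathbf{El}_{s_1}A]:\mathbf{El}_{s_2}(B\,N)$, and the rule $\mathbf{app}_{s_1,s_2}\,A\,B\,(\mathbf{abs}_{s_1,s_2}\,A'\,B'\,M)\,N\hookrightarrow M\,N$. $\Gamma\vdash_{DK}M:A$ means $\Sigma_{EPTS};\Gamma\vdash M:A$ in this theory. Translation: $[\![x]\!]=x$, $[\![s]\!]=\mathbf u_s$, $[\![\Pi_{s_1,s_2}(A,x.B)]\!]=\mathbf{Prod}_{s_1,s_2}[\![A]\!](\lambda x:\mathbf{El}_{s_1}[\![A]\!].[\![B]\!])$,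 $[\![\lambda_{s_1,s_2}(A,x.B,x.M)]\!]=\mathbf{abs}_{s_1,s_2}[\![A]\!](\lambda x:\mathbf{El}_{s_1}[\![A]\!].[\![B]\!])(\lambda x:\mathbf{El}_{s_1}[\![A]\!].[\![M]\!])$, $[\![@_{s_1,s_2}(A,x.B,M,N)]\!]=\mathbf{app}_{s_1,s_2}[\![A]\!](\lambda x:\mathbf{El}_{s_1}[\![A]\!].[\![B]\!])[\![M]\!][\![N]\!]$; on well-formed contexts $[\![-]\!]=-$ and $[\![\Gamma,x:A]\!]=[\![\Gamma]\!],x:\mathbf{El}_{s_A}[\![A]\!]$ where $\Gamma\vdash A:s_A$. -}

module Defs where

open import Data.Nat using (ℕ; zero; suc)
open import Data.Fin using (Fin; zero; suc)
open import Data.Product using (Σ; _×_; _,_)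
open import Data.Empty using (⊥)
open import Relation.Nullary using (¬_)
open import Relation.Binary.PropositionalEquality using (_≡_)
open import Relation.Binary.Construct.Closure.Equivalence using (EqClosure)

record Spec : Set₁ where
  field
    Sort : Set
    Ax   : Sort → Sort → Set
    Rl   : Sort → Sort → Sort → Set
    Ax-functional : ∀ {s s′ s″} → Ax s s′ → Ax s s″ → s′ ≡ s″
    Rl-functional : ∀ {s₁ s₂ s₃ s₃′} → Rl s₁ s₂ s₃ → Rl s₁ s₂ s₃′ → s₃ ≡ s₃′

module Theory (Sp : Spec) where
  open Spec Sp

  data Term (n : ℕ) : Set where
    var  : Fin n → Term n
    sort : Sort → Term n
    Pi   : Sort → Sort → Term n → Term (suc n) → Term n
    lam  : Sort → Sort → Term n → Term (suc n) → Term (suc n) → Term n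
    app  : Sort → Sort → Term n → Term (suc n) → Term n → Term n → Term n

  extR : ∀ {m n} → (Fin m → Fin n) → Fin (suc m) → Fin (suc n)
  extR ρ zero    = zero
  extR ρ (suc i) = suc (ρ i)

  ren : ∀ {m n} → (Fin m → Fin n) → Term m → Term n
  ren ρ (var i)            = var (ρ i)
  ren ρ (sort s)           = sort s
  ren ρ (Pi s₁ s₂ A B)     = Pi s₁ s₂ (ren ρ A) (ren (extR ρ) B)
  ren ρ (lam s₁ s₂ A B M)  = lam s₁ s₂ (ren ρ A) (ren (extR ρ) B) (ren (extR ρ) M)
  ren ρ (app s₁ s₂ A B M N) = app s₁ s₂ (ren ρ A) (ren (extR ρ) B) (ren ρ M) (ren ρ N)

  wk : ∀ {n} → Term n → Term (suc n)
  wk = ren suc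

  extS : ∀ {m n} → (Fin m → Term n) → Fin (suc m) → Term (suc n)
  extS σ zero    = var zero
  extS σ (suc i) = wk (σ i)

  sub : ∀ {m n} → (Fin m → Term n) → Term m → Term n
  sub σ (var i)            = σ i
  sub σ (sort s)           = sort s
  sub σ (Pi s₁ s₂ A B)     = Pi s₁ s₂ (sub σ A) (sub (extS σ) B)
  sub σ (lam s₁ s₂ A B M)  = lam s₁ s₂ (sub σ A) (sub (extS σ) B) (sub (extS σ) M)
  sub σ (app s₁ s₂ A B M N) = app s₁ s₂ (sub σ A) (sub (extS σ) B) (sub σ M) (sub σ N)

  single : ∀ {n} → Term n → Fin (suc n) → Term n
  single N zero    = N
  single N (suc i) = var i

  _[_] : ∀ {n} → Term (suc n) → Term n → Term n
  B [ N ] = sub (single N) B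

  infix 4 _⟶_ _≡E_
  data _⟶_ {n : ℕ} : Term n → Term n → Set where
    β : ∀ {s₁ s₂ s₃ A B A′ B′ M N} → Rl s₁ s₂ s₃ →
        app s₁ s₂ A B (lam s₁ s₂ A′ B′ M) N ⟶ M [ N ]
    Pi₁  : ∀ {s₁ s₂ A A′ B} → A ⟶ A′ → Pi s₁ s₂ A B ⟶ Pi s₁ s₂ A′ B
    Pi₂  : ∀ {s₁ s₂ A B B′} → B ⟶ B′ → Pi s₁ s₂ A B ⟶ Pi s₁ s₂ A B′
    lam₁ : ∀ {s₁ s₂ A A′ B M} → A ⟶ A′ → lam s₁ s₂ A B M ⟶ lam s₁ s₂ A′ B M
    lam₂ : ∀ {s₁ s₂ A B B′ M} → B ⟶ B′ → lam s₁ s₂ A B M ⟶ lam s₁ s₂ A B′ M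
    lam₃ : ∀ {s₁ s₂ A B M M′} → M ⟶ M′ → lam s₁ s₂ A B M ⟶ lam s₁ s₂ A B M′
    app₁ : ∀ {s₁ s₂ A A′ B M N} → A ⟶ A′ → app s₁ s₂ A B M N ⟶ app s₁ s₂ A′ B M N
    app₂ : ∀ {s₁ s₂ A B B′ M N} → B ⟶ B′ → app s₁ s₂ A B M N ⟶ app s₁ s₂ A B′ M N
    app₃ : ∀ {s₁ s₂ A B M M′ N} → M ⟶ M′ → app s₁ s₂ A B M N ⟶ app s₁ s₂ A B M′ N
    app₄ : ∀ {s₁ s₂ A B M N N′} → N ⟶ N′ → app s₁ s₂ A B M N ⟶ app s₁ s₂ A B M N′

  _≡E_ : ∀ {n} → Term n → Term n → Set
  _≡E_ {n} = EqClosure (_⟶_ {n})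

  infixl 5 _▸_
  data Ctx : ℕ → Set where
    ∅   : Ctx zero
    _▸_ : ∀ {n} → Ctx n → Term n → Ctx (suc n)

  lookup : ∀ {n} → Ctx n → Fin n → Term n
  lookup (Γ ▸ A) zero    = wk A
  lookup (Γ ▸ A) (suc i) = wk (lookup Γ i)

  infix 3 _⊢_∶_
  data WF : ∀ {n} → Ctx n → Set
  data _⊢_∶_ {n : ℕ} (Γ : Ctx n) : Term n → Term n → Set

  data WF where
    wf-∅ : WF ∅
    wf-▸ : ∀ {n} {Γ : Ctx n} {A : Term n} →
           WF Γ → (s : Sort) → Γ ⊢ A ∶ sort s → WF (Γ ▸ A)

  data _⊢_∶_ {n} Γ where
    t-conv : ∀ {M A B s} → Γ ⊢ M ∶ A → Γ ⊢ B ∶ sort s → A ≡E B → Γ ⊢ M ∶ B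
    t-sort : ∀ {s₁ s₂} → WF Γ → Ax s₁ s₂ → Γ ⊢ sort s₁ ∶ sort s₂
    t-var  : ∀ {i} → WF Γ → Γ ⊢ var i ∶ lookup Γ i
    t-prod : ∀ {s₁ s₂ s₃ A B} → Rl s₁ s₂ s₃ →
             Γ ⊢ A ∶ sort s₁ → Γ ▸ A ⊢ B ∶ sort s₂ →
             Γ ⊢ Pi s₁ s₂ A B ∶ sort s₃
    t-abs  : ∀ {s₁ s₂ s₃ A B M} → Rl s₁ s₂ s₃ →
             Γ ⊢ A ∶ sort s₁ → Γ ▸ A ⊢ B ∶ sort s₂ → Γ ▸ A ⊢ M ∶ B →
             Γ ⊢ lam s₁ s₂ A B M ∶ Pi s₁ s₂ A B
    t-app  : ∀ {s₁ s₂ s₃ A B M N} → Rl s₁ s₂ s₃ →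
             Γ ⊢ A ∶ sort s₁ → Γ ▸ A ⊢ B ∶ sort s₂ →
             Γ ⊢ N ∶ A → Γ ⊢ M ∶ Pi s₁ s₂ A B →
             Γ ⊢ app s₁ s₂ A B M N ∶ B [ N ]

  IsTopSort : ∀ {n} → Term n → Set
  IsTopSort A = Σ Sort λ s → (A ≡ sort s) × (∀ s′ → ¬ Ax s s′)

  -- Dedukti terms for the signature Σ_EPTS (constants fully applied)

  data DTerm (n : ℕ) : Set where
    dvar  : Fin n → DTerm n
    TYPE  : DTerm n
    KIND  : DTerm n
    _·_   : DTerm n → DTerm n → DTerm n
    dlam  : DTerm n → DTerm (suc n) → DTerm n
    dpi   : DTerm n → DTerm (suc n) → DTerm n
    𝐔     : Sort → DTerm n
    𝐄𝐥    : Sort → DTerm n → DTerm n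
    𝐮     : Sort → DTerm n
    𝐏𝐫𝐨𝐝  : Sort → Sort → DTerm n → DTerm n → DTerm n
    𝐚𝐛𝐬   : Sort → Sort → DTerm n → DTerm n → DTerm n → DTerm n
    𝐚𝐩𝐩   : Sort → Sort → DTerm n → DTerm n → DTerm n → DTerm n → DTerm n

  infixl 7 _·_

  dren : ∀ {m n} → (Fin m → Fin n) → DTerm m → DTerm n
  dren ρ (dvar i)          = dvar (ρ i)
  dren ρ TYPE              = TYPE
  dren ρ KIND              = KIND
  dren ρ (M · N)           = dren ρ M · dren ρ N
  dren ρ (dlam A M)        = dlam (dren ρ A) (dren (extR ρ) M)
  dren ρ (dpi A B)         = dpi (dren ρ A) (dren (extR ρ) B)
  dren ρ (𝐔 s)             = 𝐔 s
  dren ρ (𝐄𝐥 s A)          = 𝐄𝐥 s (dren ρ A)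
  dren ρ (𝐮 s)             = 𝐮 s
  dren ρ (𝐏𝐫𝐨𝐝 s₁ s₂ A B)   = 𝐏𝐫𝐨𝐝 s₁ s₂ (dren ρ A) (dren ρ B)
  dren ρ (𝐚𝐛𝐬 s₁ s₂ A B M)  = 𝐚𝐛𝐬 s₁ s₂ (dren ρ A) (dren ρ B) (dren ρ M)
  dren ρ (𝐚𝐩𝐩 s₁ s₂ A B M N) = 𝐚𝐩𝐩 s₁ s₂ (dren ρ A) (dren ρ B) (dren ρ M) (dren ρ N)

  dwk : ∀ {n} → DTerm n → DTerm (suc n)
  dwk = dren suc

  dextS : ∀ {m n} → (Fin m → DTerm n) → Fin (suc m) → DTerm (suc n)
  dextS σ zero    = dvar zero
  dextS σ (suc i) = dwk (σ i)

  dsub : ∀ {m n} → (Fin m → DTerm n) → DTerm m → DTerm n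
  dsub σ (dvar i)          = σ i
  dsub σ TYPE              = TYPE
  dsub σ KIND              = KIND
  dsub σ (M · N)           = dsub σ M · dsub σ N
  dsub σ (dlam A M)        = dlam (dsub σ A) (dsub (dextS σ) M)
  dsub σ (dpi A B)         = dpi (dsub σ A) (dsub (dextS σ) B)
  dsub σ (𝐔 s)             = 𝐔 s
  dsub σ (𝐄𝐥 s A)          = 𝐄𝐥 s (dsub σ A)
  dsub σ (𝐮 s)             = 𝐮 s
  dsub σ (𝐏𝐫𝐨𝐝 s₁ s₂ A B)   = 𝐏𝐫𝐨𝐝 s₁ s₂ (dsub σ A) (dsub σ B)
  dsub σ (𝐚𝐛𝐬 s₁ s₂ A B M)  = 𝐚𝐛𝐬 s₁ s₂ (dsub σ A) (dsub σ B) (dsub σ M)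
  dsub σ (𝐚𝐩𝐩 s₁ s₂ A B M N) = 𝐚𝐩𝐩 s₁ s₂ (dsub σ A) (dsub σ B) (dsub σ M) (dsub σ N)

  dsingle : ∀ {n} → DTerm n → Fin (suc n) → DTerm n
  dsingle N zero    = N
  dsingle N (suc i) = dvar i

  _⟨_⟩ : ∀ {n} → DTerm (suc n) → DTerm n → DTerm n
  B ⟨ N ⟩ = dsub (dsingle N) B

  _⇒_ : ∀ {n} → DTerm n → DTerm n → DTerm n
  A ⇒ B = dpi A (dwk B)

  infix 4 _⟶D_ _≡D_
  data _⟶D_ {n : ℕ} : DTerm n → DTerm n → Set where
    dβ     : ∀ {A M N} → dlam A M · N ⟶D M ⟨ N ⟩
    r-El   : ∀ {s₁ s₂} → Ax s₁ s₂ → 𝐄𝐥 s₂ (𝐮 s₁) ⟶D 𝐔 s₁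
    r-app  : ∀ {s₁ s₂ s₃ A B A′ B′ M N} → Rl s₁ s₂ s₃ →
             𝐚𝐩𝐩 s₁ s₂ A B (𝐚𝐛𝐬 s₁ s₂ A′ B′ M) N ⟶D M · N
    ·₁     : ∀ {M M′ N} → M ⟶D M′ → M · N ⟶D M′ · N
    ·₂     : ∀ {M N N′} → N ⟶D N′ → M · N ⟶D M · N′
    dlam₁  : ∀ {A A′ M} → A ⟶D A′ → dlam A M ⟶D dlam A′ M
    dlam₂  : ∀ {A M M′} → M ⟶D M′ → dlam A M ⟶D dlam A M′
    dpi₁   : ∀ {A A′ B} → A ⟶D A′ → dpi A B ⟶D dpi A′ B
    dpi₂   : ∀ {A B B′} → B ⟶D B′ → dpi A B ⟶D dpi A B′
    El₁    : ∀ {s A A′} → A ⟶D A′ → 𝐄𝐥 s A ⟶D 𝐄𝐥 s A′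
    Prod₁  : ∀ {s₁ s₂ A A′ B} → A ⟶D A′ → 𝐏𝐫𝐨𝐝 s₁ s₂ A B ⟶D 𝐏𝐫𝐨𝐝 s₁ s₂ A′ B
    Prod₂  : ∀ {s₁ s₂ A B B′} → B ⟶D B′ → 𝐏𝐫𝐨𝐝 s₁ s₂ A B ⟶D 𝐏𝐫𝐨𝐝 s₁ s₂ A B′
    abs₁   : ∀ {s₁ s₂ A A′ B M} → A ⟶D A′ → 𝐚𝐛𝐬 s₁ s₂ A B M ⟶D 𝐚𝐛𝐬 s₁ s₂ A′ B M
    abs₂   : ∀ {s₁ s₂ A B B′ M} → B ⟶D B′ → 𝐚𝐛𝐬 s₁ s₂ A B M ⟶D 𝐚𝐛𝐬 s₁ s₂ A B′ M
    abs₃   : ∀ {s₁ s₂ A B M M′} → M ⟶D M′ → 𝐚𝐛𝐬 s₁ s₂ A B M ⟶D 𝐚𝐛𝐬 s₁ s₂ A B M′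
    app₁   : ∀ {s₁ s₂ A A′ B M N} → A ⟶D A′ → 𝐚𝐩𝐩 s₁ s₂ A B M N ⟶D 𝐚𝐩𝐩 s₁ s₂ A′ B M N
    app₂   : ∀ {s₁ s₂ A B B′ M N} → B ⟶D B′ → 𝐚𝐩𝐩 s₁ s₂ A B M N ⟶D 𝐚𝐩𝐩 s₁ s₂ A B′ M N
    app₃   : ∀ {s₁ s₂ A B M M′ N} → M ⟶D M′ → 𝐚𝐩𝐩 s₁ s₂ A B M N ⟶D 𝐚𝐩𝐩 s₁ s₂ A B M′ N
    app₄   : ∀ {s₁ s₂ A B M N N′} → N ⟶D N′ → 𝐚𝐩𝐩 s₁ s₂ A B M N ⟶D 𝐚𝐩𝐩 s₁ s₂ A B M N′

  _≡D_ : ∀ {n} → DTerm n → DTerm n → Set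
  _≡D_ {n} = EqClosure (_⟶D_ {n})

  infixl 5 _▹_
  data DCtx : ℕ → Set where
    ∅   : DCtx zero
    _▹_ : ∀ {n} → DCtx n → DTerm n → DCtx (suc n)

  dlookup : ∀ {n} → DCtx n → Fin n → DTerm n
  dlookup (Γ ▹ A) zero    = dwk A
  dlookup (Γ ▹ A) (suc i) = dwk (dlookup Γ i)

  data DSort : Set where
    type kind : DSort

  ⌜_⌝ : ∀ {n} → DSort → DTerm n
  ⌜ type ⌝ = TYPE
  ⌜ kind ⌝ = KIND

  infix 3 _⊢D_∶_
  data DWF : ∀ {n} → DCtx n → Set
  data _⊢D_∶_ {n : ℕ} (Γ : DCtx n) : DTerm n → DTerm n → Set

  data DWF where
    dwf-∅ : DWF ∅
    dwf-▹ : ∀ {n} {Γ : DCtx n} {A : DTerm n} →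
            DWF Γ → Γ ⊢D A ∶ TYPE → DWF (Γ ▹ A)

  data _⊢D_∶_ {n} Γ where
    d-type : DWF Γ → Γ ⊢D TYPE ∶ KIND
    d-var  : ∀ {i} → DWF Γ → Γ ⊢D dvar i ∶ dlookup Γ i
    d-pi   : ∀ {A B} (s : DSort) →
             Γ ⊢D A ∶ TYPE → Γ ▹ A ⊢D B ∶ ⌜ s ⌝ → Γ ⊢D dpi A B ∶ ⌜ s ⌝
    d-lam  : ∀ {A B M} (s : DSort) →
             Γ ⊢D A ∶ TYPE → Γ ▹ A ⊢D B ∶ ⌜ s ⌝ → Γ ▹ A ⊢D M ∶ B →
             Γ ⊢D dlam A M ∶ dpi A B
    d-app  : ∀ {A B M N} → Γ ⊢D M ∶ dpi A B → Γ ⊢D N ∶ A → Γ ⊢D M · N ∶ B ⟨ N ⟩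
    d-conv : ∀ {M A B} (s : DSort) →
             Γ ⊢D M ∶ A → Γ ⊢D B ∶ ⌜ s ⌝ → A ≡D B → Γ ⊢D M ∶ B
    c-U    : ∀ {s} → DWF Γ → Γ ⊢D 𝐔 s ∶ TYPE
    c-El   : ∀ {s A} → DWF Γ → Γ ⊢D A ∶ 𝐔 s → Γ ⊢D 𝐄𝐥 s A ∶ TYPE
    c-u    : ∀ {s₁ s₂} → DWF Γ → Ax s₁ s₂ → Γ ⊢D 𝐮 s₁ ∶ 𝐔 s₂
    c-Prod : ∀ {s₁ s₂ s₃ A B} → DWF Γ → Rl s₁ s₂ s₃ →
             Γ ⊢D A ∶ 𝐔 s₁ → Γ ⊢D B ∶ (𝐄𝐥 s₁ A ⇒ 𝐔 s₂) →
             Γ ⊢D 𝐏𝐫𝐨𝐝 s₁ s₂ A B ∶ 𝐔 s₃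
    c-abs  : ∀ {s₁ s₂ s₃ A B M} → DWF Γ → Rl s₁ s₂ s₃ →
             Γ ⊢D A ∶ 𝐔 s₁ → Γ ⊢D B ∶ (𝐄𝐥 s₁ A ⇒ 𝐔 s₂) →
             Γ ⊢D M ∶ dpi (𝐄𝐥 s₁ A) (𝐄𝐥 s₂ (dwk B · dvar zero)) →
             Γ ⊢D 𝐚𝐛𝐬 s₁ s₂ A B M ∶ 𝐄𝐥 s₃ (𝐏𝐫𝐨𝐝 s₁ s₂ A B)
    c-app  : ∀ {s₁ s₂ s₃ A B M N} → DWF Γ → Rl s₁ s₂ s₃ →
             Γ ⊢D A ∶ 𝐔 s₁ → Γ ⊢D B ∶ (𝐄𝐥 s₁ A ⇒ 𝐔 s₂) →
             Γ ⊢D M ∶ 𝐄𝐥 s₃ (𝐏𝐫𝐨𝐝 s₁ s₂ A B) → Γ ⊢D N ∶ 𝐄𝐥 s₁ A →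
             Γ ⊢D 𝐚𝐩𝐩 s₁ s₂ A B M N ∶ 𝐄𝐥 s₂ (B · N)

  ⟦_⟧ : ∀ {n} → Term n → DTerm n
  ⟦ var i ⟧             = dvar i
  ⟦ sort s ⟧            = 𝐮 s
  ⟦ Pi s₁ s₂ A B ⟧      = 𝐏𝐫𝐨𝐝 s₁ s₂ ⟦ A ⟧ (dlam (𝐄𝐥 s₁ ⟦ A ⟧) ⟦ B ⟧)
  ⟦ lam s₁ s₂ A B M ⟧   = 𝐚𝐛𝐬 s₁ s₂ ⟦ A ⟧ (dlam (𝐄𝐥 s₁ ⟦ A ⟧) ⟦ B ⟧) (dlam (𝐄𝐥 s₁ ⟦ A ⟧) ⟦ M ⟧)
  ⟦ app s₁ s₂ A B M N ⟧ = 𝐚𝐩𝐩 s₁ s₂ ⟦ A ⟧ (dlam (𝐄𝐥 s₁ ⟦ A ⟧) ⟦ B ⟧) ⟦ M ⟧ ⟦ N ⟧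

  -- translation of a well-formed context (defined on its derivation;
  -- the sort s_A is the one recorded in the derivation of Γ ⊢ A : s_A)
  ⟦_⟧ctx : ∀ {n} {Γ : Ctx n} → WF Γ → DCtx n
  ⟦ wf-∅ ⟧ctx         = ∅
  ⟦ wf-▸ {A = A} w s _ ⟧ctx = ⟦ w ⟧ctx ▹ 𝐄𝐥 s ⟦ A ⟧

-- Soundness is proved by induction on EPTS typing derivations, establishing at once both
-- readings of the target type: ⟦M⟧ : 𝐔 s when A is the sort s, and ⟦M⟧ : 𝐄𝐥 s_A ⟦A⟧ for every
-- sort s_A of A; the two are related by the rewrite rule 𝐄𝐥 s₂ 𝐮 s₁ ↪ 𝐔 s₁. An EPTS β-step becomes
-- the 𝐚𝐩𝐩/𝐚𝐛𝐬 rule followed by a Dedukti β-step, so conversion is translated to conversion.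
-- Because ⟦Γ⟧ is read off a given well-formedness derivation, whose sorts need not be the ones
-- met elsewhere, the argument needs uniqueness of the sort of a type. This is where
-- functionality of the specification enters, through the usual metatheory: confluence
-- (Tait–Martin-Löf parallel reduction), injectivity of Π and of sorts, and subject reduction.

module Submission where

open import Defs
open import Data.Nat using (ℕ; zero; suc)
open import Data.Fin using (Fin; zero; suc)
open import Data.Product using (Σ; ∃; _×_; _,_; proj₁; proj₂)
open import Data.Sum using (_⊎_; inj₁; inj₂)
open import Function using (_∘_)
open import Relation.Nullary using (¬_)
open import Relation.Binary.Core using (Rel)
open import Relation.Binary.PropositionalEquality
  using (_≡_; _≗_; refl; sym; trans; cong; cong₂; subst; subst₂)
open import Relation.Binary.Rewriting using (Confluent)
open import Relation.Binary.Construct.Closure.ReflexiveTransitive as Star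
  using (Star; ε; _◅_; _◅◅_; kleisliStar)
open import Relation.Binary.Construct.Closure.Symmetric using (fwd; bwd)
open import Relation.Binary.Construct.Closure.Equivalence as EqClosure
  using (EqClosure)
open import Relation.Binary.Construct.Closure.Equivalence.Properties
  using (a—↠b⇒a↔b; a—↠b⇒b↔a)

cong₃ : ∀ {a b c d} {A : Set a} {B : Set b} {C : Set c} {D : Set d}
        (f : A → B → C → D) {x x′ y y′ z z′} →
        x ≡ x′ → y ≡ y′ → z ≡ z′ → f x y z ≡ f x′ y′ z′
cong₃ f refl refl refl = refl

cong₄ : ∀ {a b c d e} {A : Set a} {B : Set b} {C : Set c} {D : Set d} {E : Set e}
        (f : A → B → C → D → E) {x x′ y y′ z z′ w w′} →
        x ≡ x′ → y ≡ y′ → z ≡ z′ → w ≡ w′ → f x y z w ≡ f x′ y′ z′ w′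
cong₄ f refl refl refl refl = refl

module _ {a ℓ} {A : Set a} {R : Rel A ℓ}
         (◇ : ∀ {x y z} → R x y → R x z → ∃ λ w → R y w × R z w) where

  diamond⇒strip : ∀ {x y z} → R x y → Star R x z → ∃ λ w → Star R y w × R z w
  diamond⇒strip r ε        = _ , ε , r
  diamond⇒strip r (q ◅ qs) with ◇ r q
  ... | _ , r′ , q′ with diamond⇒strip q′ qs
  ... | _ , rs , q″ = _ , r′ ◅ rs , q″

  diamond⇒confluent : Confluent R
  diamond⇒confluent ε        ys = _ , ys , ε
  diamond⇒confluent (x ◅ xs) ys with diamond⇒strip x ys
  ... | _ , zs , y′ with diamond⇒confluent xs zs
  ... | _ , us , vs = _ , us , y′ ◅ vs

church-rosser : ∀ {a ℓ} {A : Set a} {R : Rel A ℓ} → Confluent R →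
                ∀ {x y} → EqClosure R x y → ∃ λ z → Star R x z × Star R y z
church-rosser conf ε            = _ , ε , ε
church-rosser conf (fwd r ◅ rs) with church-rosser conf rs
... | _ , xs , ys = _ , r ◅ xs , ys
church-rosser conf (bwd r ◅ rs) with church-rosser conf rs
... | _ , xs , ys with conf (r ◅ ε) xs
... | _ , us , vs = _ , us , ys ◅◅ vs

module Metatheory (Sp : Spec) where
  open Spec Sp
  open Theory Sp

  -- Renaming and substitution laws for EPTS terms

  extR-cong : ∀ {m n} {ρ ρ′ : Fin m → Fin n} → ρ ≗ ρ′ → extR ρ ≗ extR ρ′
  extR-cong h zero    = refl
  extR-cong h (suc i) = cong suc (h i)

  extR-∘ : ∀ {l m n} (ρ : Fin m → Fin n) (ρ′ : Fin l → Fin m) → extR ρ ∘ extR ρ′ ≗ extR (ρ ∘ ρ′)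
  extR-∘ ρ ρ′ zero    = refl
  extR-∘ ρ ρ′ (suc i) = refl

  ren-cong : ∀ {m n} {ρ ρ′ : Fin m → Fin n} → ρ ≗ ρ′ → ren ρ ≗ ren ρ′
  ren-cong h (var i)             = cong var (h i)
  ren-cong h (sort s)            = refl
  ren-cong h (Pi s₁ s₂ A B)      = cong₂ (Pi s₁ s₂) (ren-cong h A) (ren-cong (extR-cong h) B)
  ren-cong h (lam s₁ s₂ A B M)   =
    cong₃ (lam s₁ s₂) (ren-cong h A) (ren-cong (extR-cong h) B) (ren-cong (extR-cong h) M)
  ren-cong h (app s₁ s₂ A B M N) =
    cong₄ (app s₁ s₂) (ren-cong h A) (ren-cong (extR-cong h) B) (ren-cong h M) (ren-cong h N)

  ren-ren-ext : ∀ {l m n} (ρ : Fin m → Fin n) (ρ′ : Fin l → Fin m) →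
                ren (extR ρ) ∘ ren (extR ρ′) ≗ ren (extR (ρ ∘ ρ′))
  ren-ren : ∀ {l m n} (ρ : Fin m → Fin n) (ρ′ : Fin l → Fin m) → ren ρ ∘ ren ρ′ ≗ ren (ρ ∘ ρ′)
  ren-ren ρ ρ′ (var i)             = refl
  ren-ren ρ ρ′ (sort s)            = refl
  ren-ren ρ ρ′ (Pi s₁ s₂ A B)      = cong₂ (Pi s₁ s₂) (ren-ren ρ ρ′ A) (ren-ren-ext ρ ρ′ B)
  ren-ren ρ ρ′ (lam s₁ s₂ A B M)   =
    cong₃ (lam s₁ s₂) (ren-ren ρ ρ′ A) (ren-ren-ext ρ ρ′ B) (ren-ren-ext ρ ρ′ M)
  ren-ren ρ ρ′ (app s₁ s₂ A B M N) =
    cong₄ (app s₁ s₂) (ren-ren ρ ρ′ A) (ren-ren-ext ρ ρ′ B) (ren-ren ρ ρ′ M) (ren-ren ρ ρ′ N)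

  ren-ren-ext ρ ρ′ M = trans (ren-ren (extR ρ) (extR ρ′) M) (ren-cong (extR-∘ ρ ρ′) M)

  ren-wk : ∀ {m n} (ρ : Fin m → Fin n) → ren (extR ρ) ∘ wk ≗ wk ∘ ren ρ
  ren-wk ρ A = trans (ren-ren (extR ρ) suc A) (sym (ren-ren suc ρ A))

  extS-cong : ∀ {m n} {σ σ′ : Fin m → Term n} → σ ≗ σ′ → extS σ ≗ extS σ′
  extS-cong h zero    = refl
  extS-cong h (suc i) = cong wk (h i)

  sub-cong : ∀ {m n} {σ σ′ : Fin m → Term n} → σ ≗ σ′ → sub σ ≗ sub σ′
  sub-cong h (var i)             = h i
  sub-cong h (sort s)            = refl
  sub-cong h (Pi s₁ s₂ A B)      = cong₂ (Pi s₁ s₂) (sub-cong h A) (sub-cong (extS-cong h) B)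
  sub-cong h (lam s₁ s₂ A B M)   =
    cong₃ (lam s₁ s₂) (sub-cong h A) (sub-cong (extS-cong h) B) (sub-cong (extS-cong h) M)
  sub-cong h (app s₁ s₂ A B M N) =
    cong₄ (app s₁ s₂) (sub-cong h A) (sub-cong (extS-cong h) B) (sub-cong h M) (sub-cong h N)

  extS-extR : ∀ {l m n} (σ : Fin m → Term n) (ρ : Fin l → Fin m) → extS σ ∘ extR ρ ≗ extS (σ ∘ ρ)
  extS-extR σ ρ zero    = refl
  extS-extR σ ρ (suc i) = refl

  sub-ren-ext : ∀ {l m n} (σ : Fin m → Term n) (ρ : Fin l → Fin m) →
                sub (extS σ) ∘ ren (extR ρ) ≗ sub (extS (σ ∘ ρ))
  sub-ren : ∀ {l m n} (σ : Fin m → Term n) (ρ : Fin l → Fin m) → sub σ ∘ ren ρ ≗ sub (σ ∘ ρ)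
  sub-ren σ ρ (var i)             = refl
  sub-ren σ ρ (sort s)            = refl
  sub-ren σ ρ (Pi s₁ s₂ A B)      = cong₂ (Pi s₁ s₂) (sub-ren σ ρ A) (sub-ren-ext σ ρ B)
  sub-ren σ ρ (lam s₁ s₂ A B M)   =
    cong₃ (lam s₁ s₂) (sub-ren σ ρ A) (sub-ren-ext σ ρ B) (sub-ren-ext σ ρ M)
  sub-ren σ ρ (app s₁ s₂ A B M N) =
    cong₄ (app s₁ s₂) (sub-ren σ ρ A) (sub-ren-ext σ ρ B) (sub-ren σ ρ M) (sub-ren σ ρ N)

  sub-ren-ext σ ρ M = trans (sub-ren (extS σ) (extR ρ) M) (sub-cong (extS-extR σ ρ) M)

  extR-extS : ∀ {l m n} (ρ : Fin m → Fin n) (σ : Fin l → Term m) →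
              ren (extR ρ) ∘ extS σ ≗ extS (ren ρ ∘ σ)
  extR-extS ρ σ zero    = refl
  extR-extS ρ σ (suc i) = ren-wk ρ (σ i)

  ren-sub-ext : ∀ {l m n} (ρ : Fin m → Fin n) (σ : Fin l → Term m) →
                ren (extR ρ) ∘ sub (extS σ) ≗ sub (extS (ren ρ ∘ σ))
  ren-sub : ∀ {l m n} (ρ : Fin m → Fin n) (σ : Fin l → Term m) → ren ρ ∘ sub σ ≗ sub (ren ρ ∘ σ)
  ren-sub ρ σ (var i)             = refl
  ren-sub ρ σ (sort s)            = refl
  ren-sub ρ σ (Pi s₁ s₂ A B)      = cong₂ (Pi s₁ s₂) (ren-sub ρ σ A) (ren-sub-ext ρ σ B)
  ren-sub ρ σ (lam s₁ s₂ A B M)   =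
    cong₃ (lam s₁ s₂) (ren-sub ρ σ A) (ren-sub-ext ρ σ B) (ren-sub-ext ρ σ M)
  ren-sub ρ σ (app s₁ s₂ A B M N) =
    cong₄ (app s₁ s₂) (ren-sub ρ σ A) (ren-sub-ext ρ σ B) (ren-sub ρ σ M) (ren-sub ρ σ N)

  ren-sub-ext ρ σ M = trans (ren-sub (extR ρ) (extS σ) M) (sub-cong (extR-extS ρ σ) M)

  sub-wk : ∀ {m n} (σ : Fin m → Term n) → sub (extS σ) ∘ wk ≗ wk ∘ sub σ
  sub-wk σ A = trans (sub-ren (extS σ) suc A) (sym (ren-sub suc σ A))

  extS-sub : ∀ {l m n} (σ : Fin m → Term n) (τ : Fin l → Term m) →
             sub (extS σ) ∘ extS τ ≗ extS (sub σ ∘ τ)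
  extS-sub σ τ zero    = refl
  extS-sub σ τ (suc i) = sub-wk σ (τ i)

  sub-sub-ext : ∀ {l m n} (σ : Fin m → Term n) (τ : Fin l → Term m) →
                sub (extS σ) ∘ sub (extS τ) ≗ sub (extS (sub σ ∘ τ))
  sub-sub : ∀ {l m n} (σ : Fin m → Term n) (τ : Fin l → Term m) → sub σ ∘ sub τ ≗ sub (sub σ ∘ τ)
  sub-sub σ τ (var i)             = refl
  sub-sub σ τ (sort s)            = refl
  sub-sub σ τ (Pi s₁ s₂ A B)      = cong₂ (Pi s₁ s₂) (sub-sub σ τ A) (sub-sub-ext σ τ B)
  sub-sub σ τ (lam s₁ s₂ A B M)   =
    cong₃ (lam s₁ s₂) (sub-sub σ τ A) (sub-sub-ext σ τ B) (sub-sub-ext σ τ M)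
  sub-sub σ τ (app s₁ s₂ A B M N) =
    cong₄ (app s₁ s₂) (sub-sub σ τ A) (sub-sub-ext σ τ B) (sub-sub σ τ M) (sub-sub σ τ N)

  sub-sub-ext σ τ M = trans (sub-sub (extS σ) (extS τ) M) (sub-cong (extS-sub σ τ) M)

  extS-var : ∀ {n} → extS {n} var ≗ var
  extS-var zero    = refl
  extS-var (suc i) = refl

  sub-var-ext : ∀ {n} → sub (extS {n} var) ≗ (λ M → M)
  sub-var : ∀ {n} → sub {n} var ≗ (λ M → M)
  sub-var (var i)             = refl
  sub-var (sort s)            = refl
  sub-var (Pi s₁ s₂ A B)      = cong₂ (Pi s₁ s₂) (sub-var A) (sub-var-ext B)
  sub-var (lam s₁ s₂ A B M)   = cong₃ (lam s₁ s₂) (sub-var A) (sub-var-ext B) (sub-var-ext M)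
  sub-var (app s₁ s₂ A B M N) = cong₄ (app s₁ s₂) (sub-var A) (sub-var-ext B) (sub-var M) (sub-var N)

  sub-var-ext M = trans (sub-cong extS-var M) (sub-var M)

  wk-[] : ∀ {n} (N : Term n) A → wk A [ N ] ≡ A
  wk-[] N A = trans (sub-ren (single N) suc A) (sub-var A)

  ren-[] : ∀ {m n} (ρ : Fin m → Fin n) B N → ren ρ (B [ N ]) ≡ ren (extR ρ) B [ ren ρ N ]
  ren-[] ρ B N = trans (ren-sub ρ (single N) B)
                       (trans (sub-cong single-ren B) (sym (sub-ren (single (ren ρ N)) (extR ρ) B)))
    where
      single-ren : ren ρ ∘ single N ≗ single (ren ρ N) ∘ extR ρ
      single-ren zero    = refl
      single-ren (suc i) = refl

  sub-[] : ∀ {m n} (σ : Fin m → Term n) B N → sub σ (B [ N ]) ≡ sub (extS σ) B [ sub σ N ]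
  sub-[] σ B N = trans (sub-sub σ (single N) B)
                       (trans (sub-cong single-sub B) (sym (sub-sub (single (sub σ N)) (extS σ) B)))
    where
      single-sub : sub σ ∘ single N ≗ sub (single (sub σ N)) ∘ extS σ
      single-sub zero    = refl
      single-sub (suc i) = sym (wk-[] (sub σ N) (σ i))

  -- Confluence of EPTS reduction

  infix 4 _⟶*_ _⇉_

  _⟶*_ : ∀ {n} → Term n → Term n → Set
  _⟶*_ = Star _⟶_

  β≡ : ∀ {n s₁ s₂ s₃ A B A′ B′ M} {N P : Term n} → Rl s₁ s₂ s₃ → M [ N ] ≡ P →
       app s₁ s₂ A B (lam s₁ s₂ A′ B′ M) N ⟶ P
  β≡ r refl = β r

  ren-⟶ : ∀ {m n} (ρ : Fin m → Fin n) {M N} → M ⟶ N → ren ρ M ⟶ ren ρ N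
  ren-⟶ ρ (β {M = M} {N = N} r) = β≡ r (sym (ren-[] ρ M N))
  ren-⟶ ρ (Pi₁ r)  = Pi₁ (ren-⟶ ρ r)
  ren-⟶ ρ (Pi₂ r)  = Pi₂ (ren-⟶ (extR ρ) r)
  ren-⟶ ρ (lam₁ r) = lam₁ (ren-⟶ ρ r)
  ren-⟶ ρ (lam₂ r) = lam₂ (ren-⟶ (extR ρ) r)
  ren-⟶ ρ (lam₃ r) = lam₃ (ren-⟶ (extR ρ) r)
  ren-⟶ ρ (app₁ r) = app₁ (ren-⟶ ρ r)
  ren-⟶ ρ (app₂ r) = app₂ (ren-⟶ (extR ρ) r)
  ren-⟶ ρ (app₃ r) = app₃ (ren-⟶ ρ r)
  ren-⟶ ρ (app₄ r) = app₄ (ren-⟶ ρ r)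

  sub-⟶ : ∀ {m n} (σ : Fin m → Term n) {M N} → M ⟶ N → sub σ M ⟶ sub σ N
  sub-⟶ σ (β {M = M} {N = N} r) = β≡ r (sym (sub-[] σ M N))
  sub-⟶ σ (Pi₁ r)  = Pi₁ (sub-⟶ σ r)
  sub-⟶ σ (Pi₂ r)  = Pi₂ (sub-⟶ (extS σ) r)
  sub-⟶ σ (lam₁ r) = lam₁ (sub-⟶ σ r)
  sub-⟶ σ (lam₂ r) = lam₂ (sub-⟶ (extS σ) r)
  sub-⟶ σ (lam₃ r) = lam₃ (sub-⟶ (extS σ) r)
  sub-⟶ σ (app₁ r) = app₁ (sub-⟶ σ r)
  sub-⟶ σ (app₂ r) = app₂ (sub-⟶ (extS σ) r)
  sub-⟶ σ (app₃ r) = app₃ (sub-⟶ σ r)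
  sub-⟶ σ (app₄ r) = app₄ (sub-⟶ σ r)

  ren-≡E : ∀ {m n} (ρ : Fin m → Fin n) {M N} → M ≡E N → ren ρ M ≡E ren ρ N
  ren-≡E ρ = EqClosure.gmap (ren ρ) (ren-⟶ ρ)

  sub-≡E : ∀ {m n} (σ : Fin m → Term n) {M N} → M ≡E N → sub σ M ≡E sub σ N
  sub-≡E σ = EqClosure.gmap (sub σ) (sub-⟶ σ)

  Pi-cong* : ∀ {n s₁ s₂} {A A′ : Term n} {B B′} → A ⟶* A′ → B ⟶* B′ →
             Pi s₁ s₂ A B ⟶* Pi s₁ s₂ A′ B′
  Pi-cong* {A′ = A′} {B} a b = Star.gmap (λ X → Pi _ _ X B) Pi₁ a ◅◅ Star.gmap (Pi _ _ A′) Pi₂ b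

  lam-cong* : ∀ {n s₁ s₂} {A A′ : Term n} {B B′ M M′} → A ⟶* A′ → B ⟶* B′ → M ⟶* M′ →
              lam s₁ s₂ A B M ⟶* lam s₁ s₂ A′ B′ M′
  lam-cong* {A′ = A′} {B} {B′} {M} a b m =
    Star.gmap (λ X → lam _ _ X B M) lam₁ a ◅◅
    Star.gmap (λ X → lam _ _ A′ X M) lam₂ b ◅◅ Star.gmap (lam _ _ A′ B′) lam₃ m

  app-cong* : ∀ {n s₁ s₂} {A A′ : Term n} {B B′ M M′ N N′} →
              A ⟶* A′ → B ⟶* B′ → M ⟶* M′ → N ⟶* N′ →
              app s₁ s₂ A B M N ⟶* app s₁ s₂ A′ B′ M′ N′
  app-cong* {A′ = A′} {B} {B′} {M} {M′} {N} a b m n =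
    Star.gmap (λ X → app _ _ X B M N) app₁ a ◅◅ Star.gmap (λ X → app _ _ A′ X M N) app₂ b ◅◅
    Star.gmap (λ X → app _ _ A′ B′ X N) app₃ m ◅◅ Star.gmap (app _ _ A′ B′ M′) app₄ n

  data _⇉_ {n : ℕ} : Term n → Term n → Set where
    pvar : ∀ {i} → var i ⇉ var i
    psort : ∀ {s} → sort s ⇉ sort s
    pPi : ∀ {s₁ s₂ A A′ B B′} → A ⇉ A′ → B ⇉ B′ → Pi s₁ s₂ A B ⇉ Pi s₁ s₂ A′ B′
    plam : ∀ {s₁ s₂ A A′ B B′ M M′} → A ⇉ A′ → B ⇉ B′ → M ⇉ M′ →
           lam s₁ s₂ A B M ⇉ lam s₁ s₂ A′ B′ M′
    papp : ∀ {s₁ s₂ A A′ B B′ M M′ N N′} → A ⇉ A′ → B ⇉ B′ → M ⇉ M′ → N ⇉ N′ →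
           app s₁ s₂ A B M N ⇉ app s₁ s₂ A′ B′ M′ N′
    pβ : ∀ {s₁ s₂ s₃ A B A₂ B₂ M M′ N N′} → Rl s₁ s₂ s₃ → M ⇉ M′ → N ⇉ N′ →
         app s₁ s₂ A B (lam s₁ s₂ A₂ B₂ M) N ⇉ M′ [ N′ ]

  pβ≡ : ∀ {n s₁ s₂ s₃ A B A₂ B₂ M M′ N N′} {P : Term n} → Rl s₁ s₂ s₃ → M ⇉ M′ → N ⇉ N′ →
        M′ [ N′ ] ≡ P → app s₁ s₂ A B (lam s₁ s₂ A₂ B₂ M) N ⇉ P
  pβ≡ r m n refl = pβ r m n

  ⇉-refl : ∀ {n} (M : Term n) → M ⇉ M
  ⇉-refl (var i)             = pvar
  ⇉-refl (sort s)            = psort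
  ⇉-refl (Pi s₁ s₂ A B)      = pPi (⇉-refl A) (⇉-refl B)
  ⇉-refl (lam s₁ s₂ A B M)   = plam (⇉-refl A) (⇉-refl B) (⇉-refl M)
  ⇉-refl (app s₁ s₂ A B M N) = papp (⇉-refl A) (⇉-refl B) (⇉-refl M) (⇉-refl N)

  ⟶⇒⇉ : ∀ {n} {M N : Term n} → M ⟶ N → M ⇉ N
  ⟶⇒⇉ (β {M = M} {N = N} r) = pβ r (⇉-refl M) (⇉-refl N)
  ⟶⇒⇉ (Pi₁ r)  = pPi (⟶⇒⇉ r) (⇉-refl _)
  ⟶⇒⇉ (Pi₂ r)  = pPi (⇉-refl _) (⟶⇒⇉ r)
  ⟶⇒⇉ (lam₁ r) = plam (⟶⇒⇉ r) (⇉-refl _) (⇉-refl _)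
  ⟶⇒⇉ (lam₂ r) = plam (⇉-refl _) (⟶⇒⇉ r) (⇉-refl _)
  ⟶⇒⇉ (lam₃ r) = plam (⇉-refl _) (⇉-refl _) (⟶⇒⇉ r)
  ⟶⇒⇉ (app₁ r) = papp (⟶⇒⇉ r) (⇉-refl _) (⇉-refl _) (⇉-refl _)
  ⟶⇒⇉ (app₂ r) = papp (⇉-refl _) (⟶⇒⇉ r) (⇉-refl _) (⇉-refl _)
  ⟶⇒⇉ (app₃ r) = papp (⇉-refl _) (⇉-refl _) (⟶⇒⇉ r) (⇉-refl _)
  ⟶⇒⇉ (app₄ r) = papp (⇉-refl _) (⇉-refl _) (⇉-refl _) (⟶⇒⇉ r)

  ⇉⇒⟶* : ∀ {n} {M N : Term n} → M ⇉ N → M ⟶* N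
  ⇉⇒⟶* pvar             = ε
  ⇉⇒⟶* psort            = ε
  ⇉⇒⟶* (pPi a b)        = Pi-cong* (⇉⇒⟶* a) (⇉⇒⟶* b)
  ⇉⇒⟶* (plam a b m)     = lam-cong* (⇉⇒⟶* a) (⇉⇒⟶* b) (⇉⇒⟶* m)
  ⇉⇒⟶* (papp a b m n)   = app-cong* (⇉⇒⟶* a) (⇉⇒⟶* b) (⇉⇒⟶* m) (⇉⇒⟶* n)
  ⇉⇒⟶* (pβ r m n)       = app-cong* ε ε (lam-cong* ε ε (⇉⇒⟶* m)) (⇉⇒⟶* n) ◅◅ β r ◅ ε

  ren-⇉ : ∀ {m n} (ρ : Fin m → Fin n) {M N} → M ⇉ N → ren ρ M ⇉ ren ρ N
  ren-⇉ ρ pvar           = pvar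
  ren-⇉ ρ psort          = psort
  ren-⇉ ρ (pPi a b)      = pPi (ren-⇉ ρ a) (ren-⇉ (extR ρ) b)
  ren-⇉ ρ (plam a b m)   = plam (ren-⇉ ρ a) (ren-⇉ (extR ρ) b) (ren-⇉ (extR ρ) m)
  ren-⇉ ρ (papp a b m n) = papp (ren-⇉ ρ a) (ren-⇉ (extR ρ) b) (ren-⇉ ρ m) (ren-⇉ ρ n)
  ren-⇉ ρ (pβ {M′ = M′} {N′ = N′} r m n) =
    pβ≡ r (ren-⇉ (extR ρ) m) (ren-⇉ ρ n) (sym (ren-[] ρ M′ N′))

  extS-⇉ : ∀ {m n} {σ τ : Fin m → Term n} → (∀ i → σ i ⇉ τ i) → ∀ i → extS σ i ⇉ extS τ i
  extS-⇉ h zero    = pvar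
  extS-⇉ h (suc i) = ren-⇉ suc (h i)

  sub-⇉ : ∀ {m n} {σ τ : Fin m → Term n} → (∀ i → σ i ⇉ τ i) → ∀ {M N} → M ⇉ N → sub σ M ⇉ sub τ N
  sub-⇉ h pvar           = h _
  sub-⇉ h psort          = psort
  sub-⇉ h (pPi a b)      = pPi (sub-⇉ h a) (sub-⇉ (extS-⇉ h) b)
  sub-⇉ h (plam a b m)   = plam (sub-⇉ h a) (sub-⇉ (extS-⇉ h) b) (sub-⇉ (extS-⇉ h) m)
  sub-⇉ h (papp a b m n) = papp (sub-⇉ h a) (sub-⇉ (extS-⇉ h) b) (sub-⇉ h m) (sub-⇉ h n)
  sub-⇉ {τ = τ} h (pβ {M′ = M′} {N′ = N′} r m n) =
    pβ≡ r (sub-⇉ (extS-⇉ h) m) (sub-⇉ h n) (sym (sub-[] τ M′ N′))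

  []-⇉ : ∀ {n} {M M′ : Term (suc n)} {N N′} → M ⇉ M′ → N ⇉ N′ → M [ N ] ⇉ M′ [ N′ ]
  []-⇉ m n = sub-⇉ (λ { zero → n ; (suc i) → pvar }) m

  ⇉-diamond : ∀ {n} {M P Q : Term n} → M ⇉ P → M ⇉ Q → ∃ λ R → P ⇉ R × Q ⇉ R
  ⇉-diamond pvar pvar   = _ , pvar , pvar
  ⇉-diamond psort psort = _ , psort , psort
  ⇉-diamond (pPi a b) (pPi a′ b′) with ⇉-diamond a a′ | ⇉-diamond b b′
  ... | _ , a₁ , a₂ | _ , b₁ , b₂ = _ , pPi a₁ b₁ , pPi a₂ b₂
  ⇉-diamond (plam a b m) (plam a′ b′ m′) with ⇉-diamond a a′ | ⇉-diamond b b′ | ⇉-diamond m m′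
  ... | _ , a₁ , a₂ | _ , b₁ , b₂ | _ , m₁ , m₂ = _ , plam a₁ b₁ m₁ , plam a₂ b₂ m₂
  ⇉-diamond (papp a b m n) (papp a′ b′ m′ n′)
    with ⇉-diamond a a′ | ⇉-diamond b b′ | ⇉-diamond m m′ | ⇉-diamond n n′
  ... | _ , a₁ , a₂ | _ , b₁ , b₂ | _ , m₁ , m₂ | _ , n₁ , n₂ =
    _ , papp a₁ b₁ m₁ n₁ , papp a₂ b₂ m₂ n₂
  ⇉-diamond (papp _ _ (plam _ _ m) n) (pβ r m′ n′) with ⇉-diamond m m′ | ⇉-diamond n n′
  ... | _ , m₁ , m₂ | _ , n₁ , n₂ = _ , pβ r m₁ n₁ , []-⇉ m₂ n₂
  ⇉-diamond (pβ r m n) (papp _ _ (plam _ _ m′) n′) with ⇉-diamond m m′ | ⇉-diamond n n′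
  ... | _ , m₁ , m₂ | _ , n₁ , n₂ = _ , []-⇉ m₁ n₁ , pβ r m₂ n₂
  ⇉-diamond (pβ r m n) (pβ _ m′ n′) with ⇉-diamond m m′ | ⇉-diamond n n′
  ... | _ , m₁ , m₂ | _ , n₁ , n₂ = _ , []-⇉ m₁ n₁ , []-⇉ m₂ n₂

  ⟶-confluent : ∀ {n} → Confluent (_⟶_ {n})
  ⟶-confluent p q with diamond⇒confluent ⇉-diamond (Star.map ⟶⇒⇉ p) (Star.map ⟶⇒⇉ q)
  ... | _ , p′ , q′ = _ , kleisliStar _ ⇉⇒⟶* p′ , kleisliStar _ ⇉⇒⟶* q′

  sort-⟶*-inv : ∀ {n s} {X : Term n} → sort s ⟶* X → X ≡ sort s
  sort-⟶*-inv ε       = refl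
  sort-⟶*-inv (() ◅ _)

  sort-≡E-inj : ∀ {n s s′} → sort {n} s ≡E sort s′ → s ≡ s′
  sort-≡E-inj e with church-rosser ⟶-confluent e
  ... | _ , p , q with trans (sym (sort-⟶*-inv p)) (sort-⟶*-inv q)
  ... | refl = refl

  Pi-⟶*-inv : ∀ {n s₁ s₂} {A : Term n} {B X} → Pi s₁ s₂ A B ⟶* X →
              ∃ λ A′ → ∃ λ B′ → X ≡ Pi s₁ s₂ A′ B′ × A ⟶* A′ × B ⟶* B′
  Pi-⟶*-inv ε = _ , _ , refl , ε , ε
  Pi-⟶*-inv (Pi₁ r ◅ rs) with Pi-⟶*-inv rs
  ... | _ , _ , refl , a , b = _ , _ , refl , r ◅ a , b
  Pi-⟶*-inv (Pi₂ r ◅ rs) with Pi-⟶*-inv rs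
  ... | _ , _ , refl , a , b = _ , _ , refl , a , r ◅ b

  joinable⇒≡E : ∀ {n} {M N R : Term n} → M ⟶* R → N ⟶* R → M ≡E N
  joinable⇒≡E p q = a—↠b⇒a↔b p ◅◅ a—↠b⇒b↔a q

  Pi-≡E-inj : ∀ {n s₁ s₂} {A A′ : Term n} {B B′} →
              Pi s₁ s₂ A B ≡E Pi s₁ s₂ A′ B′ → A ≡E A′ × B ≡E B′
  Pi-≡E-inj e with church-rosser ⟶-confluent e
  ... | _ , p , q with Pi-⟶*-inv p | Pi-⟶*-inv q
  ... | _ , _ , refl , a , b | _ , _ , refl , a′ , b′ =
    joinable⇒≡E a a′ , joinable⇒≡E b b′

  -- Metatheory of EPTS typing

  ⊢⇒WF : ∀ {n} {Γ : Ctx n} {M A} → Γ ⊢ M ∶ A → WF Γ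
  ⊢⇒WF (t-conv d _ _)      = ⊢⇒WF d
  ⊢⇒WF (t-sort w _)        = w
  ⊢⇒WF (t-var w)           = w
  ⊢⇒WF (t-prod _ a _)      = ⊢⇒WF a
  ⊢⇒WF (t-abs _ a _ _)     = ⊢⇒WF a
  ⊢⇒WF (t-app _ a _ _ _)   = ⊢⇒WF a

  retype : ∀ {n} {Γ : Ctx n} {M A A′} → A ≡ A′ → Γ ⊢ M ∶ A → Γ ⊢ M ∶ A′
  retype refl d = d

  TypedRen : ∀ {m n} → (Fin m → Fin n) → Ctx m → Ctx n → Set
  TypedRen ρ Γ Δ = ∀ i → lookup Δ (ρ i) ≡ ren ρ (lookup Γ i)

  TypedRen-ext : ∀ {m n} {ρ : Fin m → Fin n} {Γ Δ} A → TypedRen ρ Γ Δ →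
                 TypedRen (extR ρ) (Γ ▸ A) (Δ ▸ ren ρ A)
  TypedRen-ext {ρ = ρ} A h zero        = sym (ren-wk ρ A)
  TypedRen-ext {ρ = ρ} {Γ} A h (suc i) = trans (cong wk (h i)) (sym (ren-wk ρ (lookup Γ i)))

  ⊢-ren : ∀ {m n} {Γ : Ctx m} {Δ : Ctx n} {ρ : Fin m → Fin n} {M A} →
          Γ ⊢ M ∶ A → WF Δ → TypedRen ρ Γ Δ → Δ ⊢ ren ρ M ∶ ren ρ A
  ⊢-ren {ρ = ρ} (t-conv d b e) w h = t-conv (⊢-ren d w h) (⊢-ren b w h) (ren-≡E ρ e)
  ⊢-ren (t-sort _ ax)              w h = t-sort w ax
  ⊢-ren (t-var {i = i} _)          w h = retype (h i) (t-var w)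
  ⊢-ren (t-prod {s₁ = s₁} {A = A} r a b) w h =
    t-prod r a′ (⊢-ren b (wf-▸ w s₁ a′) (TypedRen-ext A h))
    where a′ = ⊢-ren a w h
  ⊢-ren (t-abs {s₁ = s₁} {A = A} r a b m) w h =
    t-abs r a′ (⊢-ren b w′ (TypedRen-ext A h)) (⊢-ren m w′ (TypedRen-ext A h))
    where a′ = ⊢-ren a w h
          w′ = wf-▸ w s₁ a′
  ⊢-ren {ρ = ρ} (t-app {s₁ = s₁} {A = A} {B} {N = N} r a b n m) w h =
    retype (sym (ren-[] ρ B N))
      (t-app r a′ (⊢-ren b (wf-▸ w s₁ a′) (TypedRen-ext A h)) (⊢-ren n w h) (⊢-ren m w h))
    where a′ = ⊢-ren a w h

  ⊢-wk : ∀ {n} {Γ : Ctx n} {B M A} → Γ ⊢ M ∶ A → WF (Γ ▸ B) → Γ ▸ B ⊢ wk M ∶ wk A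
  ⊢-wk d w = ⊢-ren d w (λ i → refl)

  TypedSub : ∀ {m n} → (Fin m → Term n) → Ctx m → Ctx n → Set
  TypedSub σ Γ Δ = ∀ i → Δ ⊢ σ i ∶ sub σ (lookup Γ i)

  TypedSub-ext : ∀ {m n} {σ : Fin m → Term n} {Γ Δ} A → WF (Δ ▸ sub σ A) → TypedSub σ Γ Δ →
                 TypedSub (extS σ) (Γ ▸ A) (Δ ▸ sub σ A)
  TypedSub-ext {σ = σ} A w h zero        = retype (sym (sub-wk σ A)) (t-var w)
  TypedSub-ext {σ = σ} {Γ} A w h (suc i) = retype (sym (sub-wk σ (lookup Γ i))) (⊢-wk (h i) w)

  ⊢-sub : ∀ {m n} {Γ : Ctx m} {Δ : Ctx n} {σ : Fin m → Term n} {M A} →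
          Γ ⊢ M ∶ A → WF Δ → TypedSub σ Γ Δ → Δ ⊢ sub σ M ∶ sub σ A
  ⊢-sub {σ = σ} (t-conv d b e) w h = t-conv (⊢-sub d w h) (⊢-sub b w h) (sub-≡E σ e)
  ⊢-sub (t-sort _ ax)              w h = t-sort w ax
  ⊢-sub (t-var {i = i} _)          w h = h i
  ⊢-sub (t-prod {s₁ = s₁} {A = A} r a b) w h =
    t-prod r a′ (⊢-sub b w′ (TypedSub-ext A w′ h))
    where a′ = ⊢-sub a w h
          w′ = wf-▸ w s₁ a′
  ⊢-sub (t-abs {s₁ = s₁} {A = A} r a b m) w h =
    t-abs r a′ (⊢-sub b w′ (TypedSub-ext A w′ h)) (⊢-sub m w′ (TypedSub-ext A w′ h))
    where a′ = ⊢-sub a w h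
          w′ = wf-▸ w s₁ a′
  ⊢-sub {σ = σ} (t-app {s₁ = s₁} {A = A} {B} {N = N} r a b n m) w h =
    retype (sym (sub-[] σ B N))
      (t-app r a′ (⊢-sub b w′ (TypedSub-ext A w′ h)) (⊢-sub n w h) (⊢-sub m w h))
    where a′ = ⊢-sub a w h
          w′ = wf-▸ w s₁ a′

  ⊢-[] : ∀ {n} {Γ : Ctx n} {A M B N} → Γ ▸ A ⊢ M ∶ B → Γ ⊢ N ∶ A → Γ ⊢ M [ N ] ∶ B [ N ]
  ⊢-[] {Γ = Γ} {A} {N = N} d n = ⊢-sub d (⊢⇒WF n) single-typed
    where
      single-typed : TypedSub (single N) (Γ ▸ A) Γ
      single-typed zero    = retype (sym (wk-[] N A)) n
      single-typed (suc i) = retype (sym (wk-[] N (lookup Γ i))) (t-var (⊢⇒WF n))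

  ⊢-ctx-conv : ∀ {n} {Γ : Ctx n} {A A′ M T s s′} → Γ ▸ A ⊢ M ∶ T →
               Γ ⊢ A′ ∶ sort s′ → A′ ≡E A → Γ ⊢ A ∶ sort s → Γ ▸ A′ ⊢ M ∶ T
  ⊢-ctx-conv {Γ = Γ} {A} {A′} {M} {T} {s′ = s′} d a′ e a =
    subst₂ (Γ ▸ A′ ⊢_∶_) (sub-var M) (sub-var T) (⊢-sub d w′ var-typed)
    where
      w′ = wf-▸ (⊢⇒WF a′) s′ a′
      var-typed : TypedSub var (Γ ▸ A) (Γ ▸ A′)
      var-typed zero    = retype (sym (sub-var (wk A)))
                                (t-conv (t-var w′) (⊢-wk a w′) (ren-≡E suc e))
      var-typed (suc i) = retype (sym (sub-var (wk (lookup Γ i)))) (t-var w′)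

  gen-sort : ∀ {n} {Γ : Ctx n} {s T} → Γ ⊢ sort s ∶ T → Σ Sort λ s′ → Ax s s′ × T ≡E sort s′
  gen-sort (t-conv d _ e) with gen-sort d
  ... | s′ , ax , p = s′ , ax , EqClosure.symmetric _ e ◅◅ p
  gen-sort (t-sort _ ax) = _ , ax , ε

  gen-var : ∀ {n} {Γ : Ctx n} {i T} → Γ ⊢ var i ∶ T → T ≡E lookup Γ i
  gen-var (t-conv d _ e) = EqClosure.symmetric _ e ◅◅ gen-var d
  gen-var (t-var _)      = ε

  gen-Pi : ∀ {n} {Γ : Ctx n} {s₁ s₂ A B T} → Γ ⊢ Pi s₁ s₂ A B ∶ T →
           Σ Sort λ s₃ → Rl s₁ s₂ s₃ × T ≡E sort s₃
  gen-Pi (t-conv d _ e) with gen-Pi d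
  ... | s₃ , r , p = s₃ , r , EqClosure.symmetric _ e ◅◅ p
  gen-Pi (t-prod r _ _) = _ , r , ε

  gen-lam : ∀ {n} {Γ : Ctx n} {s₁ s₂ A B M T} → Γ ⊢ lam s₁ s₂ A B M ∶ T →
            Γ ⊢ A ∶ sort s₁ × Γ ▸ A ⊢ M ∶ B × T ≡E Pi s₁ s₂ A B
  gen-lam (t-conv d _ e) with gen-lam d
  ... | a , m , p = a , m , EqClosure.symmetric _ e ◅◅ p
  gen-lam (t-abs _ a _ m) = a , m , ε

  gen-app : ∀ {n} {Γ : Ctx n} {s₁ s₂ A B M N T} → Γ ⊢ app s₁ s₂ A B M N ∶ T → T ≡E B [ N ]
  gen-app (t-conv d _ e)      = EqClosure.symmetric _ e ◅◅ gen-app d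
  gen-app (t-app _ _ _ _ _)   = ε

  ⊢-unique : ∀ {n} {Γ : Ctx n} {M T₁ T₂} → Γ ⊢ M ∶ T₁ → Γ ⊢ M ∶ T₂ → T₁ ≡E T₂
  ⊢-unique (t-conv d _ e) d₂ = EqClosure.symmetric _ e ◅◅ ⊢-unique d d₂
  ⊢-unique (t-sort _ ax) d₂ with gen-sort d₂
  ... | _ , ax′ , p rewrite Ax-functional ax ax′ = EqClosure.symmetric _ p
  ⊢-unique (t-var _) d₂ = EqClosure.symmetric _ (gen-var d₂)
  ⊢-unique (t-prod r _ _) d₂ with gen-Pi d₂
  ... | _ , r′ , p rewrite Rl-functional r r′ = EqClosure.symmetric _ p
  ⊢-unique (t-abs _ _ _ _) d₂   = EqClosure.symmetric _ (proj₂ (proj₂ (gen-lam d₂)))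
  ⊢-unique (t-app _ _ _ _ _) d₂ = EqClosure.symmetric _ (gen-app d₂)

  ⊢-sort-unique : ∀ {n} {Γ : Ctx n} {A s s′} → Γ ⊢ A ∶ sort s → Γ ⊢ A ∶ sort s′ → s ≡ s′
  ⊢-sort-unique a a′ = sort-≡E-inj (⊢-unique a a′)

  ⟶⇒≡E : ∀ {n} {M N : Term n} → M ⟶ N → M ≡E N
  ⟶⇒≡E r = fwd r ◅ ε

  ⟶⇒≡E⁻ : ∀ {n} {M N : Term n} → M ⟶ N → N ≡E M
  ⟶⇒≡E⁻ r = bwd r ◅ ε

  ⊢-⟶ : ∀ {n} {Γ : Ctx n} {M M′ T} → Γ ⊢ M ∶ T → M ⟶ M′ → Γ ⊢ M′ ∶ T
  ⊢-⟶ (t-conv d b e) r = t-conv (⊢-⟶ d r) b e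
  ⊢-⟶ (t-prod rl a b) (Pi₁ r) = t-prod rl a′ (⊢-ctx-conv b a′ (⟶⇒≡E⁻ r) a)
    where a′ = ⊢-⟶ a r
  ⊢-⟶ (t-prod rl a b) (Pi₂ r) = t-prod rl a (⊢-⟶ b r)
  ⊢-⟶ (t-abs rl a b m) (lam₁ r) =
    t-conv (t-abs rl a′ (⊢-ctx-conv b a′ (⟶⇒≡E⁻ r) a) (⊢-ctx-conv m a′ (⟶⇒≡E⁻ r) a))
           (t-prod rl a b) (⟶⇒≡E⁻ (Pi₁ r))
    where a′ = ⊢-⟶ a r
  ⊢-⟶ (t-abs rl a b m) (lam₂ r) =
    t-conv (t-abs rl a b′ (t-conv m b′ (⟶⇒≡E r))) (t-prod rl a b) (⟶⇒≡E⁻ (Pi₂ r))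
    where b′ = ⊢-⟶ b r
  ⊢-⟶ (t-abs rl a b m) (lam₃ r) = t-abs rl a b (⊢-⟶ m r)
  ⊢-⟶ (t-app {N = N} rl a b n m) (β _) with gen-lam m
  ... | a₀ , m₀ , p with Pi-≡E-inj p
  ... | eA , eB = t-conv (⊢-[] m₀ (t-conv n a₀ eA)) (⊢-[] b n)
                         (sub-≡E (single N) (EqClosure.symmetric _ eB))
  ⊢-⟶ (t-app rl a b n m) (app₁ r) =
    t-app rl a′ b′ (t-conv n a′ (⟶⇒≡E r)) (t-conv m (t-prod rl a′ b′) (⟶⇒≡E (Pi₁ r)))
    where a′ = ⊢-⟶ a r
          b′ = ⊢-ctx-conv b a′ (⟶⇒≡E⁻ r) a
  ⊢-⟶ (t-app {N = N} rl a b n m) (app₂ r) =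
    t-conv (t-app rl a b′ n (t-conv m (t-prod rl a b′) (⟶⇒≡E (Pi₂ r))))
           (⊢-[] b n) (sub-≡E (single N) (⟶⇒≡E⁻ r))
    where b′ = ⊢-⟶ b r
  ⊢-⟶ (t-app rl a b n m) (app₃ r) = t-app rl a b n (⊢-⟶ m r)
  ⊢-⟶ (t-app {B = B} rl a b n m) (app₄ r) =
    t-conv (t-app rl a b (⊢-⟶ n r) m) (⊢-[] b n)
           (a—↠b⇒b↔a (⇉⇒⟶* ([]-⇉ (⇉-refl B) (⟶⇒⇉ r))))

  ⊢-⟶* : ∀ {n} {Γ : Ctx n} {M M′ T} → Γ ⊢ M ∶ T → M ⟶* M′ → Γ ⊢ M′ ∶ T
  ⊢-⟶* d ε        = d
  ⊢-⟶* d (r ◅ rs) = ⊢-⟶* (⊢-⟶ d r) rs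

  ≡E-sort-unique : ∀ {n} {Γ : Ctx n} {A A′ s s′} →
                   Γ ⊢ A ∶ sort s → Γ ⊢ A′ ∶ sort s′ → A ≡E A′ → s ≡ s′
  ≡E-sort-unique a a′ e with church-rosser ⟶-confluent e
  ... | _ , p , q = ⊢-sort-unique (⊢-⟶* a p) (⊢-⟶* a′ q)

  -- Renaming and substitution laws for Dedukti terms

  dren-cong : ∀ {m n} {ρ ρ′ : Fin m → Fin n} → ρ ≗ ρ′ → dren ρ ≗ dren ρ′
  dren-cong h (dvar i)            = cong dvar (h i)
  dren-cong h TYPE                = refl
  dren-cong h KIND                = refl
  dren-cong h (M · N)             = cong₂ _·_ (dren-cong h M) (dren-cong h N)
  dren-cong h (dlam A M)          = cong₂ dlam (dren-cong h A) (dren-cong (extR-cong h) M)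
  dren-cong h (dpi A B)           = cong₂ dpi (dren-cong h A) (dren-cong (extR-cong h) B)
  dren-cong h (𝐔 s)               = refl
  dren-cong h (𝐄𝐥 s A)            = cong (𝐄𝐥 s) (dren-cong h A)
  dren-cong h (𝐮 s)               = refl
  dren-cong h (𝐏𝐫𝐨𝐝 s₁ s₂ A B)     = cong₂ (𝐏𝐫𝐨𝐝 s₁ s₂) (dren-cong h A) (dren-cong h B)
  dren-cong h (𝐚𝐛𝐬 s₁ s₂ A B M)    = cong₃ (𝐚𝐛𝐬 s₁ s₂) (dren-cong h A) (dren-cong h B) (dren-cong h M)
  dren-cong h (𝐚𝐩𝐩 s₁ s₂ A B M N)  =
    cong₄ (𝐚𝐩𝐩 s₁ s₂) (dren-cong h A) (dren-cong h B) (dren-cong h M) (dren-cong h N)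

  dren-dren-ext : ∀ {l m n} (ρ : Fin m → Fin n) (ρ′ : Fin l → Fin m) →
                  dren (extR ρ) ∘ dren (extR ρ′) ≗ dren (extR (ρ ∘ ρ′))
  dren-dren : ∀ {l m n} (ρ : Fin m → Fin n) (ρ′ : Fin l → Fin m) → dren ρ ∘ dren ρ′ ≗ dren (ρ ∘ ρ′)
  dren-dren ρ ρ′ (dvar i)           = refl
  dren-dren ρ ρ′ TYPE               = refl
  dren-dren ρ ρ′ KIND               = refl
  dren-dren ρ ρ′ (M · N)            = cong₂ _·_ (dren-dren ρ ρ′ M) (dren-dren ρ ρ′ N)
  dren-dren ρ ρ′ (dlam A M)         = cong₂ dlam (dren-dren ρ ρ′ A) (dren-dren-ext ρ ρ′ M)
  dren-dren ρ ρ′ (dpi A B)          = cong₂ dpi (dren-dren ρ ρ′ A) (dren-dren-ext ρ ρ′ B)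
  dren-dren ρ ρ′ (𝐔 s)              = refl
  dren-dren ρ ρ′ (𝐄𝐥 s A)           = cong (𝐄𝐥 s) (dren-dren ρ ρ′ A)
  dren-dren ρ ρ′ (𝐮 s)              = refl
  dren-dren ρ ρ′ (𝐏𝐫𝐨𝐝 s₁ s₂ A B)    = cong₂ (𝐏𝐫𝐨𝐝 s₁ s₂) (dren-dren ρ ρ′ A) (dren-dren ρ ρ′ B)
  dren-dren ρ ρ′ (𝐚𝐛𝐬 s₁ s₂ A B M)   =
    cong₃ (𝐚𝐛𝐬 s₁ s₂) (dren-dren ρ ρ′ A) (dren-dren ρ ρ′ B) (dren-dren ρ ρ′ M)
  dren-dren ρ ρ′ (𝐚𝐩𝐩 s₁ s₂ A B M N) =
    cong₄ (𝐚𝐩𝐩 s₁ s₂) (dren-dren ρ ρ′ A) (dren-dren ρ ρ′ B) (dren-dren ρ ρ′ M) (dren-dren ρ ρ′ N)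

  dren-dren-ext ρ ρ′ M = trans (dren-dren (extR ρ) (extR ρ′) M) (dren-cong (extR-∘ ρ ρ′) M)

  dren-dwk : ∀ {m n} (ρ : Fin m → Fin n) → dren (extR ρ) ∘ dwk ≗ dwk ∘ dren ρ
  dren-dwk ρ A = trans (dren-dren (extR ρ) suc A) (sym (dren-dren suc ρ A))

  dextS-cong : ∀ {m n} {σ σ′ : Fin m → DTerm n} → σ ≗ σ′ → dextS σ ≗ dextS σ′
  dextS-cong h zero    = refl
  dextS-cong h (suc i) = cong dwk (h i)

  dsub-cong : ∀ {m n} {σ σ′ : Fin m → DTerm n} → σ ≗ σ′ → dsub σ ≗ dsub σ′
  dsub-cong h (dvar i)            = h i
  dsub-cong h TYPE                = refl
  dsub-cong h KIND                = refl
  dsub-cong h (M · N)             = cong₂ _·_ (dsub-cong h M) (dsub-cong h N)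
  dsub-cong h (dlam A M)          = cong₂ dlam (dsub-cong h A) (dsub-cong (dextS-cong h) M)
  dsub-cong h (dpi A B)           = cong₂ dpi (dsub-cong h A) (dsub-cong (dextS-cong h) B)
  dsub-cong h (𝐔 s)               = refl
  dsub-cong h (𝐄𝐥 s A)            = cong (𝐄𝐥 s) (dsub-cong h A)
  dsub-cong h (𝐮 s)               = refl
  dsub-cong h (𝐏𝐫𝐨𝐝 s₁ s₂ A B)     = cong₂ (𝐏𝐫𝐨𝐝 s₁ s₂) (dsub-cong h A) (dsub-cong h B)
  dsub-cong h (𝐚𝐛𝐬 s₁ s₂ A B M)    = cong₃ (𝐚𝐛𝐬 s₁ s₂) (dsub-cong h A) (dsub-cong h B) (dsub-cong h M)
  dsub-cong h (𝐚𝐩𝐩 s₁ s₂ A B M N)  =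
    cong₄ (𝐚𝐩𝐩 s₁ s₂) (dsub-cong h A) (dsub-cong h B) (dsub-cong h M) (dsub-cong h N)

  dextS-extR : ∀ {l m n} (σ : Fin m → DTerm n) (ρ : Fin l → Fin m) → dextS σ ∘ extR ρ ≗ dextS (σ ∘ ρ)
  dextS-extR σ ρ zero    = refl
  dextS-extR σ ρ (suc i) = refl

  dsub-dren-ext : ∀ {l m n} (σ : Fin m → DTerm n) (ρ : Fin l → Fin m) →
                  dsub (dextS σ) ∘ dren (extR ρ) ≗ dsub (dextS (σ ∘ ρ))
  dsub-dren : ∀ {l m n} (σ : Fin m → DTerm n) (ρ : Fin l → Fin m) → dsub σ ∘ dren ρ ≗ dsub (σ ∘ ρ)
  dsub-dren σ ρ (dvar i)           = refl
  dsub-dren σ ρ TYPE               = refl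
  dsub-dren σ ρ KIND               = refl
  dsub-dren σ ρ (M · N)            = cong₂ _·_ (dsub-dren σ ρ M) (dsub-dren σ ρ N)
  dsub-dren σ ρ (dlam A M)         = cong₂ dlam (dsub-dren σ ρ A) (dsub-dren-ext σ ρ M)
  dsub-dren σ ρ (dpi A B)          = cong₂ dpi (dsub-dren σ ρ A) (dsub-dren-ext σ ρ B)
  dsub-dren σ ρ (𝐔 s)              = refl
  dsub-dren σ ρ (𝐄𝐥 s A)           = cong (𝐄𝐥 s) (dsub-dren σ ρ A)
  dsub-dren σ ρ (𝐮 s)              = refl
  dsub-dren σ ρ (𝐏𝐫𝐨𝐝 s₁ s₂ A B)    = cong₂ (𝐏𝐫𝐨𝐝 s₁ s₂) (dsub-dren σ ρ A) (dsub-dren σ ρ B)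
  dsub-dren σ ρ (𝐚𝐛𝐬 s₁ s₂ A B M)   =
    cong₃ (𝐚𝐛𝐬 s₁ s₂) (dsub-dren σ ρ A) (dsub-dren σ ρ B) (dsub-dren σ ρ M)
  dsub-dren σ ρ (𝐚𝐩𝐩 s₁ s₂ A B M N) =
    cong₄ (𝐚𝐩𝐩 s₁ s₂) (dsub-dren σ ρ A) (dsub-dren σ ρ B) (dsub-dren σ ρ M) (dsub-dren σ ρ N)

  dsub-dren-ext σ ρ M = trans (dsub-dren (dextS σ) (extR ρ) M) (dsub-cong (dextS-extR σ ρ) M)

  extR-dextS : ∀ {l m n} (ρ : Fin m → Fin n) (σ : Fin l → DTerm m) →
               dren (extR ρ) ∘ dextS σ ≗ dextS (dren ρ ∘ σ)
  extR-dextS ρ σ zero    = refl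
  extR-dextS ρ σ (suc i) = dren-dwk ρ (σ i)

  dren-dsub-ext : ∀ {l m n} (ρ : Fin m → Fin n) (σ : Fin l → DTerm m) →
                  dren (extR ρ) ∘ dsub (dextS σ) ≗ dsub (dextS (dren ρ ∘ σ))
  dren-dsub : ∀ {l m n} (ρ : Fin m → Fin n) (σ : Fin l → DTerm m) → dren ρ ∘ dsub σ ≗ dsub (dren ρ ∘ σ)
  dren-dsub ρ σ (dvar i)           = refl
  dren-dsub ρ σ TYPE               = refl
  dren-dsub ρ σ KIND               = refl
  dren-dsub ρ σ (M · N)            = cong₂ _·_ (dren-dsub ρ σ M) (dren-dsub ρ σ N)
  dren-dsub ρ σ (dlam A M)         = cong₂ dlam (dren-dsub ρ σ A) (dren-dsub-ext ρ σ M)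
  dren-dsub ρ σ (dpi A B)          = cong₂ dpi (dren-dsub ρ σ A) (dren-dsub-ext ρ σ B)
  dren-dsub ρ σ (𝐔 s)              = refl
  dren-dsub ρ σ (𝐄𝐥 s A)           = cong (𝐄𝐥 s) (dren-dsub ρ σ A)
  dren-dsub ρ σ (𝐮 s)              = refl
  dren-dsub ρ σ (𝐏𝐫𝐨𝐝 s₁ s₂ A B)    = cong₂ (𝐏𝐫𝐨𝐝 s₁ s₂) (dren-dsub ρ σ A) (dren-dsub ρ σ B)
  dren-dsub ρ σ (𝐚𝐛𝐬 s₁ s₂ A B M)   =
    cong₃ (𝐚𝐛𝐬 s₁ s₂) (dren-dsub ρ σ A) (dren-dsub ρ σ B) (dren-dsub ρ σ M)
  dren-dsub ρ σ (𝐚𝐩𝐩 s₁ s₂ A B M N) =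
    cong₄ (𝐚𝐩𝐩 s₁ s₂) (dren-dsub ρ σ A) (dren-dsub ρ σ B) (dren-dsub ρ σ M) (dren-dsub ρ σ N)

  dren-dsub-ext ρ σ M = trans (dren-dsub (extR ρ) (dextS σ) M) (dsub-cong (extR-dextS ρ σ) M)

  dsub-dwk : ∀ {m n} (σ : Fin m → DTerm n) → dsub (dextS σ) ∘ dwk ≗ dwk ∘ dsub σ
  dsub-dwk σ A = trans (dsub-dren (dextS σ) suc A) (sym (dren-dsub suc σ A))

  dextS-dsub : ∀ {l m n} (σ : Fin m → DTerm n) (τ : Fin l → DTerm m) →
               dsub (dextS σ) ∘ dextS τ ≗ dextS (dsub σ ∘ τ)
  dextS-dsub σ τ zero    = refl
  dextS-dsub σ τ (suc i) = dsub-dwk σ (τ i)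

  dsub-dsub-ext : ∀ {l m n} (σ : Fin m → DTerm n) (τ : Fin l → DTerm m) →
                  dsub (dextS σ) ∘ dsub (dextS τ) ≗ dsub (dextS (dsub σ ∘ τ))
  dsub-dsub : ∀ {l m n} (σ : Fin m → DTerm n) (τ : Fin l → DTerm m) → dsub σ ∘ dsub τ ≗ dsub (dsub σ ∘ τ)
  dsub-dsub σ τ (dvar i)           = refl
  dsub-dsub σ τ TYPE               = refl
  dsub-dsub σ τ KIND               = refl
  dsub-dsub σ τ (M · N)            = cong₂ _·_ (dsub-dsub σ τ M) (dsub-dsub σ τ N)
  dsub-dsub σ τ (dlam A M)         = cong₂ dlam (dsub-dsub σ τ A) (dsub-dsub-ext σ τ M)
  dsub-dsub σ τ (dpi A B)          = cong₂ dpi (dsub-dsub σ τ A) (dsub-dsub-ext σ τ B)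
  dsub-dsub σ τ (𝐔 s)              = refl
  dsub-dsub σ τ (𝐄𝐥 s A)           = cong (𝐄𝐥 s) (dsub-dsub σ τ A)
  dsub-dsub σ τ (𝐮 s)              = refl
  dsub-dsub σ τ (𝐏𝐫𝐨𝐝 s₁ s₂ A B)    = cong₂ (𝐏𝐫𝐨𝐝 s₁ s₂) (dsub-dsub σ τ A) (dsub-dsub σ τ B)
  dsub-dsub σ τ (𝐚𝐛𝐬 s₁ s₂ A B M)   =
    cong₃ (𝐚𝐛𝐬 s₁ s₂) (dsub-dsub σ τ A) (dsub-dsub σ τ B) (dsub-dsub σ τ M)
  dsub-dsub σ τ (𝐚𝐩𝐩 s₁ s₂ A B M N) =
    cong₄ (𝐚𝐩𝐩 s₁ s₂) (dsub-dsub σ τ A) (dsub-dsub σ τ B) (dsub-dsub σ τ M) (dsub-dsub σ τ N)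

  dsub-dsub-ext σ τ M = trans (dsub-dsub (dextS σ) (dextS τ) M) (dsub-cong (dextS-dsub σ τ) M)

  dextS-dvar : ∀ {n} → dextS {n} dvar ≗ dvar
  dextS-dvar zero    = refl
  dextS-dvar (suc i) = refl

  dsub-dvar-ext : ∀ {n} → dsub (dextS {n} dvar) ≗ (λ M → M)
  dsub-dvar : ∀ {n} → dsub {n} dvar ≗ (λ M → M)
  dsub-dvar (dvar i)           = refl
  dsub-dvar TYPE               = refl
  dsub-dvar KIND               = refl
  dsub-dvar (M · N)            = cong₂ _·_ (dsub-dvar M) (dsub-dvar N)
  dsub-dvar (dlam A M)         = cong₂ dlam (dsub-dvar A) (dsub-dvar-ext M)
  dsub-dvar (dpi A B)          = cong₂ dpi (dsub-dvar A) (dsub-dvar-ext B)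
  dsub-dvar (𝐔 s)              = refl
  dsub-dvar (𝐄𝐥 s A)           = cong (𝐄𝐥 s) (dsub-dvar A)
  dsub-dvar (𝐮 s)              = refl
  dsub-dvar (𝐏𝐫𝐨𝐝 s₁ s₂ A B)    = cong₂ (𝐏𝐫𝐨𝐝 s₁ s₂) (dsub-dvar A) (dsub-dvar B)
  dsub-dvar (𝐚𝐛𝐬 s₁ s₂ A B M)   = cong₃ (𝐚𝐛𝐬 s₁ s₂) (dsub-dvar A) (dsub-dvar B) (dsub-dvar M)
  dsub-dvar (𝐚𝐩𝐩 s₁ s₂ A B M N) =
    cong₄ (𝐚𝐩𝐩 s₁ s₂) (dsub-dvar A) (dsub-dvar B) (dsub-dvar M) (dsub-dvar N)

  dsub-dvar-ext M = trans (dsub-cong dextS-dvar M) (dsub-dvar M)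

  dwk-⟨⟩ : ∀ {n} (N : DTerm n) A → dwk A ⟨ N ⟩ ≡ A
  dwk-⟨⟩ N A = trans (dsub-dren (dsingle N) suc A) (dsub-dvar A)

  dren-⟨⟩ : ∀ {m n} (ρ : Fin m → Fin n) B N → dren ρ (B ⟨ N ⟩) ≡ dren (extR ρ) B ⟨ dren ρ N ⟩
  dren-⟨⟩ ρ B N = trans (dren-dsub ρ (dsingle N) B)
                        (trans (dsub-cong dsingle-dren B) (sym (dsub-dren (dsingle (dren ρ N)) (extR ρ) B)))
    where
      dsingle-dren : dren ρ ∘ dsingle N ≗ dsingle (dren ρ N) ∘ extR ρ
      dsingle-dren zero    = refl
      dsingle-dren (suc i) = refl

  dsub-⟨⟩ : ∀ {m n} (σ : Fin m → DTerm n) B N → dsub σ (B ⟨ N ⟩) ≡ dsub (dextS σ) B ⟨ dsub σ N ⟩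
  dsub-⟨⟩ σ B N = trans (dsub-dsub σ (dsingle N) B)
                        (trans (dsub-cong dsingle-dsub B) (sym (dsub-dsub (dsingle (dsub σ N)) (dextS σ) B)))
    where
      dsingle-dsub : dsub σ ∘ dsingle N ≗ dsub (dsingle (dsub σ N)) ∘ dextS σ
      dsingle-dsub zero    = refl
      dsingle-dsub (suc i) = sym (dwk-⟨⟩ (dsub σ N) (σ i))

  dren-extR-suc-⟨dvar0⟩ : ∀ {n} (Y : DTerm (suc n)) → dren (extR suc) Y ⟨ dvar zero ⟩ ≡ Y
  dren-extR-suc-⟨dvar0⟩ Y = trans (dsub-dren (dsingle (dvar zero)) (extR suc) Y)
                                  (trans (dsub-cong dsingle-extR-suc Y) (dsub-dvar Y))
    where
      dsingle-extR-suc : dsingle (dvar zero) ∘ extR suc ≗ dvar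
      dsingle-extR-suc zero    = refl
      dsingle-extR-suc (suc i) = refl

  -- Metatheory of Dedukti typing

  infix 4 _⟶D*_

  _⟶D*_ : ∀ {n} → DTerm n → DTerm n → Set
  _⟶D*_ = Star _⟶D_

  dβ≡ : ∀ {n A M} {N P : DTerm n} → M ⟨ N ⟩ ≡ P → dlam A M · N ⟶D P
  dβ≡ refl = dβ

  dren-⟶D : ∀ {m n} (ρ : Fin m → Fin n) {M N} → M ⟶D N → dren ρ M ⟶D dren ρ N
  dren-⟶D ρ (dβ {M = M} {N = N}) = dβ≡ (sym (dren-⟨⟩ ρ M N))
  dren-⟶D ρ (r-El ax)  = r-El ax
  dren-⟶D ρ (r-app r)  = r-app r
  dren-⟶D ρ (·₁ r)     = ·₁ (dren-⟶D ρ r)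
  dren-⟶D ρ (·₂ r)     = ·₂ (dren-⟶D ρ r)
  dren-⟶D ρ (dlam₁ r)  = dlam₁ (dren-⟶D ρ r)
  dren-⟶D ρ (dlam₂ r)  = dlam₂ (dren-⟶D (extR ρ) r)
  dren-⟶D ρ (dpi₁ r)   = dpi₁ (dren-⟶D ρ r)
  dren-⟶D ρ (dpi₂ r)   = dpi₂ (dren-⟶D (extR ρ) r)
  dren-⟶D ρ (El₁ r)    = El₁ (dren-⟶D ρ r)
  dren-⟶D ρ (Prod₁ r)  = Prod₁ (dren-⟶D ρ r)
  dren-⟶D ρ (Prod₂ r)  = Prod₂ (dren-⟶D ρ r)
  dren-⟶D ρ (abs₁ r)   = abs₁ (dren-⟶D ρ r)
  dren-⟶D ρ (abs₂ r)   = abs₂ (dren-⟶D ρ r)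
  dren-⟶D ρ (abs₃ r)   = abs₃ (dren-⟶D ρ r)
  dren-⟶D ρ (app₁ r)   = app₁ (dren-⟶D ρ r)
  dren-⟶D ρ (app₂ r)   = app₂ (dren-⟶D ρ r)
  dren-⟶D ρ (app₃ r)   = app₃ (dren-⟶D ρ r)
  dren-⟶D ρ (app₄ r)   = app₄ (dren-⟶D ρ r)

  dsub-⟶D : ∀ {m n} (σ : Fin m → DTerm n) {M N} → M ⟶D N → dsub σ M ⟶D dsub σ N
  dsub-⟶D σ (dβ {M = M} {N = N}) = dβ≡ (sym (dsub-⟨⟩ σ M N))
  dsub-⟶D σ (r-El ax)  = r-El ax
  dsub-⟶D σ (r-app r)  = r-app r
  dsub-⟶D σ (·₁ r)     = ·₁ (dsub-⟶D σ r)
  dsub-⟶D σ (·₂ r)     = ·₂ (dsub-⟶D σ r)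
  dsub-⟶D σ (dlam₁ r)  = dlam₁ (dsub-⟶D σ r)
  dsub-⟶D σ (dlam₂ r)  = dlam₂ (dsub-⟶D (dextS σ) r)
  dsub-⟶D σ (dpi₁ r)   = dpi₁ (dsub-⟶D σ r)
  dsub-⟶D σ (dpi₂ r)   = dpi₂ (dsub-⟶D (dextS σ) r)
  dsub-⟶D σ (El₁ r)    = El₁ (dsub-⟶D σ r)
  dsub-⟶D σ (Prod₁ r)  = Prod₁ (dsub-⟶D σ r)
  dsub-⟶D σ (Prod₂ r)  = Prod₂ (dsub-⟶D σ r)
  dsub-⟶D σ (abs₁ r)   = abs₁ (dsub-⟶D σ r)
  dsub-⟶D σ (abs₂ r)   = abs₂ (dsub-⟶D σ r)
  dsub-⟶D σ (abs₃ r)   = abs₃ (dsub-⟶D σ r)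
  dsub-⟶D σ (app₁ r)   = app₁ (dsub-⟶D σ r)
  dsub-⟶D σ (app₂ r)   = app₂ (dsub-⟶D σ r)
  dsub-⟶D σ (app₃ r)   = app₃ (dsub-⟶D σ r)
  dsub-⟶D σ (app₄ r)   = app₄ (dsub-⟶D σ r)

  dren-≡D : ∀ {m n} (ρ : Fin m → Fin n) {M N} → M ≡D N → dren ρ M ≡D dren ρ N
  dren-≡D ρ = EqClosure.gmap (dren ρ) (dren-⟶D ρ)

  dsub-≡D : ∀ {m n} (σ : Fin m → DTerm n) {M N} → M ≡D N → dsub σ M ≡D dsub σ N
  dsub-≡D σ = EqClosure.gmap (dsub σ) (dsub-⟶D σ)

  dretype : ∀ {n} {Γ : DCtx n} {M A A′} → A ≡ A′ → Γ ⊢D M ∶ A → Γ ⊢D M ∶ A′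
  dretype refl d = d

  dren-⌜⌝ : ∀ {m n} (ρ : Fin m → Fin n) s → dren ρ ⌜ s ⌝ ≡ ⌜ s ⌝
  dren-⌜⌝ ρ type = refl
  dren-⌜⌝ ρ kind = refl

  dsub-⌜⌝ : ∀ {m n} (σ : Fin m → DTerm n) s → dsub σ ⌜ s ⌝ ≡ ⌜ s ⌝
  dsub-⌜⌝ σ type = refl
  dsub-⌜⌝ σ kind = refl

  TypedDRen : ∀ {m n} → (Fin m → Fin n) → DCtx m → DCtx n → Set
  TypedDRen ρ Γ Δ = ∀ i → dlookup Δ (ρ i) ≡ dren ρ (dlookup Γ i)

  TypedDRen-ext : ∀ {m n} {ρ : Fin m → Fin n} {Γ Δ} A → TypedDRen ρ Γ Δ →
                  TypedDRen (extR ρ) (Γ ▹ A) (Δ ▹ dren ρ A)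
  TypedDRen-ext {ρ = ρ} A h zero        = sym (dren-dwk ρ A)
  TypedDRen-ext {ρ = ρ} {Γ} A h (suc i) = trans (cong dwk (h i)) (sym (dren-dwk ρ (dlookup Γ i)))

  ⊢D-ren : ∀ {m n} {Γ : DCtx m} {Δ : DCtx n} {ρ : Fin m → Fin n} {M A} →
           Γ ⊢D M ∶ A → DWF Δ → TypedDRen ρ Γ Δ → Δ ⊢D dren ρ M ∶ dren ρ A
  ⊢D-ren (d-type _)       w h = d-type w
  ⊢D-ren (d-var {i = i} _) w h = dretype (h i) (d-var w)
  ⊢D-ren {ρ = ρ} (d-pi {A = A} s a b) w h =
    dretype (sym (dren-⌜⌝ ρ s))
      (d-pi s a′ (dretype (dren-⌜⌝ (extR ρ) s) (⊢D-ren b (dwf-▹ w a′) (TypedDRen-ext A h))))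
    where a′ = ⊢D-ren a w h
  ⊢D-ren {ρ = ρ} (d-lam {A = A} s a b m) w h =
    d-lam s a′ (dretype (dren-⌜⌝ (extR ρ) s) (⊢D-ren b w′ (TypedDRen-ext A h)))
               (⊢D-ren m w′ (TypedDRen-ext A h))
    where a′ = ⊢D-ren a w h
          w′ = dwf-▹ w a′
  ⊢D-ren {ρ = ρ} (d-app {B = B} {N = N} m n) w h =
    dretype (sym (dren-⟨⟩ ρ B N)) (d-app (⊢D-ren m w h) (⊢D-ren n w h))
  ⊢D-ren {ρ = ρ} (d-conv s d b e) w h =
    d-conv s (⊢D-ren d w h) (dretype (dren-⌜⌝ ρ s) (⊢D-ren b w h)) (dren-≡D ρ e)
  ⊢D-ren (c-U _)          w h = c-U w
  ⊢D-ren (c-El _ a)       w h = c-El w (⊢D-ren a w h)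
  ⊢D-ren (c-u _ ax)       w h = c-u w ax
  ⊢D-ren (c-Prod _ r a b) w h = c-Prod w r (⊢D-ren a w h) (⊢D-ren b w h)
  ⊢D-ren {ρ = ρ} (c-abs {s₂ = s₂} {A = A} {B} _ r a b m) w h =
    c-abs w r (⊢D-ren a w h) (⊢D-ren b w h)
      (dretype (cong (λ X → dpi (𝐄𝐥 _ (dren ρ A)) (𝐄𝐥 s₂ (X · dvar zero))) (dren-dwk ρ B))
               (⊢D-ren m w h))
  ⊢D-ren (c-app _ r a b m n) w h =
    c-app w r (⊢D-ren a w h) (⊢D-ren b w h) (⊢D-ren m w h) (⊢D-ren n w h)

  ⊢D-wk : ∀ {n} {Γ : DCtx n} {B M A} → Γ ⊢D M ∶ A → DWF (Γ ▹ B) → Γ ▹ B ⊢D dwk M ∶ dwk A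
  ⊢D-wk d w = ⊢D-ren d w (λ i → refl)

  TypedDSub : ∀ {m n} → (Fin m → DTerm n) → DCtx m → DCtx n → Set
  TypedDSub σ Γ Δ = ∀ i → Δ ⊢D σ i ∶ dsub σ (dlookup Γ i)

  TypedDSub-ext : ∀ {m n} {σ : Fin m → DTerm n} {Γ Δ} A → DWF (Δ ▹ dsub σ A) → TypedDSub σ Γ Δ →
                  TypedDSub (dextS σ) (Γ ▹ A) (Δ ▹ dsub σ A)
  TypedDSub-ext {σ = σ} A w h zero        = dretype (sym (dsub-dwk σ A)) (d-var w)
  TypedDSub-ext {σ = σ} {Γ} A w h (suc i) = dretype (sym (dsub-dwk σ (dlookup Γ i))) (⊢D-wk (h i) w)

  ⊢D-sub : ∀ {m n} {Γ : DCtx m} {Δ : DCtx n} {σ : Fin m → DTerm n} {M A} →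
           Γ ⊢D M ∶ A → DWF Δ → TypedDSub σ Γ Δ → Δ ⊢D dsub σ M ∶ dsub σ A
  ⊢D-sub (d-type _)        w h = d-type w
  ⊢D-sub (d-var {i = i} _) w h = h i
  ⊢D-sub {σ = σ} (d-pi {A = A} s a b) w h =
    dretype (sym (dsub-⌜⌝ σ s))
      (d-pi s a′ (dretype (dsub-⌜⌝ (dextS σ) s) (⊢D-sub b w′ (TypedDSub-ext A w′ h))))
    where a′ = ⊢D-sub a w h
          w′ = dwf-▹ w a′
  ⊢D-sub {σ = σ} (d-lam {A = A} s a b m) w h =
    d-lam s a′ (dretype (dsub-⌜⌝ (dextS σ) s) (⊢D-sub b w′ (TypedDSub-ext A w′ h)))
               (⊢D-sub m w′ (TypedDSub-ext A w′ h))
    where a′ = ⊢D-sub a w h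
          w′ = dwf-▹ w a′
  ⊢D-sub {σ = σ} (d-app {B = B} {N = N} m n) w h =
    dretype (sym (dsub-⟨⟩ σ B N)) (d-app (⊢D-sub m w h) (⊢D-sub n w h))
  ⊢D-sub {σ = σ} (d-conv s d b e) w h =
    d-conv s (⊢D-sub d w h) (dretype (dsub-⌜⌝ σ s) (⊢D-sub b w h)) (dsub-≡D σ e)
  ⊢D-sub (c-U _)          w h = c-U w
  ⊢D-sub (c-El _ a)       w h = c-El w (⊢D-sub a w h)
  ⊢D-sub (c-u _ ax)       w h = c-u w ax
  ⊢D-sub (c-Prod _ r a b) w h = c-Prod w r (⊢D-sub a w h) (⊢D-sub b w h)
  ⊢D-sub {σ = σ} (c-abs {s₂ = s₂} {A = A} {B} _ r a b m) w h =
    c-abs w r (⊢D-sub a w h) (⊢D-sub b w h)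
      (dretype (cong (λ X → dpi (𝐄𝐥 _ (dsub σ A)) (𝐄𝐥 s₂ (X · dvar zero))) (dsub-dwk σ B))
               (⊢D-sub m w h))
  ⊢D-sub (c-app _ r a b m n) w h =
    c-app w r (⊢D-sub a w h) (⊢D-sub b w h) (⊢D-sub m w h) (⊢D-sub n w h)

  ⊢D-⟨⟩ : ∀ {n} {Γ : DCtx n} {A M B N} → DWF Γ → Γ ▹ A ⊢D M ∶ B → Γ ⊢D N ∶ A →
          Γ ⊢D M ⟨ N ⟩ ∶ B ⟨ N ⟩
  ⊢D-⟨⟩ {Γ = Γ} {A} {N = N} w d n = ⊢D-sub d w dsingle-typed
    where
      dsingle-typed : TypedDSub (dsingle N) (Γ ▹ A) Γ
      dsingle-typed zero    = dretype (sym (dwk-⟨⟩ N A)) n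
      dsingle-typed (suc i) = dretype (sym (dwk-⟨⟩ N (dlookup Γ i))) (d-var w)

  -- Translation, substitution and conversion

  ⟦⟧-ren : ∀ {m n} (ρ : Fin m → Fin n) M → ⟦ ren ρ M ⟧ ≡ dren ρ ⟦ M ⟧
  ⟦⟧-ren ρ (var i)             = refl
  ⟦⟧-ren ρ (sort s)            = refl
  ⟦⟧-ren ρ (Pi s₁ s₂ A B)      =
    cong₂ (λ X Y → 𝐏𝐫𝐨𝐝 s₁ s₂ X (dlam (𝐄𝐥 s₁ X) Y)) (⟦⟧-ren ρ A) (⟦⟧-ren (extR ρ) B)
  ⟦⟧-ren ρ (lam s₁ s₂ A B M)   =
    cong₃ (λ X Y Z → 𝐚𝐛𝐬 s₁ s₂ X (dlam (𝐄𝐥 s₁ X) Y) (dlam (𝐄𝐥 s₁ X) Z))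
          (⟦⟧-ren ρ A) (⟦⟧-ren (extR ρ) B) (⟦⟧-ren (extR ρ) M)
  ⟦⟧-ren ρ (app s₁ s₂ A B M N) =
    cong₄ (λ X Y Z W → 𝐚𝐩𝐩 s₁ s₂ X (dlam (𝐄𝐥 s₁ X) Y) Z W)
          (⟦⟧-ren ρ A) (⟦⟧-ren (extR ρ) B) (⟦⟧-ren ρ M) (⟦⟧-ren ρ N)

  ⟦⟧-extS : ∀ {m n} (σ : Fin m → Term n) → ⟦_⟧ ∘ extS σ ≗ dextS (⟦_⟧ ∘ σ)
  ⟦⟧-extS σ zero    = refl
  ⟦⟧-extS σ (suc i) = ⟦⟧-ren suc (σ i)

  ⟦⟧-sub-ext : ∀ {m n} (σ : Fin m → Term n) M → ⟦ sub (extS σ) M ⟧ ≡ dsub (dextS (⟦_⟧ ∘ σ)) ⟦ M ⟧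
  ⟦⟧-sub : ∀ {m n} (σ : Fin m → Term n) M → ⟦ sub σ M ⟧ ≡ dsub (⟦_⟧ ∘ σ) ⟦ M ⟧
  ⟦⟧-sub σ (var i)             = refl
  ⟦⟧-sub σ (sort s)            = refl
  ⟦⟧-sub σ (Pi s₁ s₂ A B)      =
    cong₂ (λ X Y → 𝐏𝐫𝐨𝐝 s₁ s₂ X (dlam (𝐄𝐥 s₁ X) Y)) (⟦⟧-sub σ A) (⟦⟧-sub-ext σ B)
  ⟦⟧-sub σ (lam s₁ s₂ A B M)   =
    cong₃ (λ X Y Z → 𝐚𝐛𝐬 s₁ s₂ X (dlam (𝐄𝐥 s₁ X) Y) (dlam (𝐄𝐥 s₁ X) Z))
          (⟦⟧-sub σ A) (⟦⟧-sub-ext σ B) (⟦⟧-sub-ext σ M)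
  ⟦⟧-sub σ (app s₁ s₂ A B M N) =
    cong₄ (λ X Y Z W → 𝐚𝐩𝐩 s₁ s₂ X (dlam (𝐄𝐥 s₁ X) Y) Z W)
          (⟦⟧-sub σ A) (⟦⟧-sub-ext σ B) (⟦⟧-sub σ M) (⟦⟧-sub σ N)

  ⟦⟧-sub-ext σ M = trans (⟦⟧-sub (extS σ) M) (dsub-cong (⟦⟧-extS σ) ⟦ M ⟧)

  ⟦⟧-[] : ∀ {n} (B : Term (suc n)) N → ⟦ B [ N ] ⟧ ≡ ⟦ B ⟧ ⟨ ⟦ N ⟧ ⟩
  ⟦⟧-[] B N = trans (⟦⟧-sub (single N) B) (dsub-cong ⟦⟧-single ⟦ B ⟧)
    where
      ⟦⟧-single : ⟦_⟧ ∘ single N ≗ dsingle ⟦ N ⟧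
      ⟦⟧-single zero    = refl
      ⟦⟧-single (suc i) = refl

  𝐄𝐥-cong* : ∀ {n s} {A A′ : DTerm n} → A ⟶D* A′ → 𝐄𝐥 s A ⟶D* 𝐄𝐥 s A′
  𝐄𝐥-cong* = Star.gmap (𝐄𝐥 _) El₁

  dlam-cong* : ∀ {n} {A A′ : DTerm n} {M M′} → A ⟶D* A′ → M ⟶D* M′ → dlam A M ⟶D* dlam A′ M′
  dlam-cong* {A′ = A′} {M} a m = Star.gmap (λ X → dlam X M) dlam₁ a ◅◅ Star.gmap (dlam A′) dlam₂ m

  𝐏𝐫𝐨𝐝-cong* : ∀ {n s₁ s₂} {A A′ : DTerm n} {B B′} → A ⟶D* A′ → B ⟶D* B′ →
               𝐏𝐫𝐨𝐝 s₁ s₂ A B ⟶D* 𝐏𝐫𝐨𝐝 s₁ s₂ A′ B′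
  𝐏𝐫𝐨𝐝-cong* {A′ = A′} {B} a b =
    Star.gmap (λ X → 𝐏𝐫𝐨𝐝 _ _ X B) Prod₁ a ◅◅ Star.gmap (𝐏𝐫𝐨𝐝 _ _ A′) Prod₂ b

  𝐚𝐛𝐬-cong* : ∀ {n s₁ s₂} {A A′ : DTerm n} {B B′ M M′} → A ⟶D* A′ → B ⟶D* B′ → M ⟶D* M′ →
              𝐚𝐛𝐬 s₁ s₂ A B M ⟶D* 𝐚𝐛𝐬 s₁ s₂ A′ B′ M′
  𝐚𝐛𝐬-cong* {A′ = A′} {B} {B′} {M} a b m =
    Star.gmap (λ X → 𝐚𝐛𝐬 _ _ X B M) abs₁ a ◅◅
    Star.gmap (λ X → 𝐚𝐛𝐬 _ _ A′ X M) abs₂ b ◅◅ Star.gmap (𝐚𝐛𝐬 _ _ A′ B′) abs₃ m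

  𝐚𝐩𝐩-cong* : ∀ {n s₁ s₂} {A A′ : DTerm n} {B B′ M M′ N N′} →
              A ⟶D* A′ → B ⟶D* B′ → M ⟶D* M′ → N ⟶D* N′ →
              𝐚𝐩𝐩 s₁ s₂ A B M N ⟶D* 𝐚𝐩𝐩 s₁ s₂ A′ B′ M′ N′
  𝐚𝐩𝐩-cong* {A′ = A′} {B} {B′} {M} {M′} {N} a b m n =
    Star.gmap (λ X → 𝐚𝐩𝐩 _ _ X B M N) app₁ a ◅◅ Star.gmap (λ X → 𝐚𝐩𝐩 _ _ A′ X M N) app₂ b ◅◅
    Star.gmap (λ X → 𝐚𝐩𝐩 _ _ A′ B′ X N) app₃ m ◅◅ Star.gmap (𝐚𝐩𝐩 _ _ A′ B′ M′) app₄ n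

  ⟦⟧-⇉ : ∀ {n} {M N : Term n} → M ⇉ N → ⟦ M ⟧ ⟶D* ⟦ N ⟧
  ⟦⟧-⇉ pvar  = ε
  ⟦⟧-⇉ psort = ε
  ⟦⟧-⇉ (pPi a b) = 𝐏𝐫𝐨𝐝-cong* (⟦⟧-⇉ a) (dlam-cong* (𝐄𝐥-cong* (⟦⟧-⇉ a)) (⟦⟧-⇉ b))
  ⟦⟧-⇉ (plam a b m) =
    𝐚𝐛𝐬-cong* (⟦⟧-⇉ a) (dlam-cong* (𝐄𝐥-cong* (⟦⟧-⇉ a)) (⟦⟧-⇉ b))
                      (dlam-cong* (𝐄𝐥-cong* (⟦⟧-⇉ a)) (⟦⟧-⇉ m))
  ⟦⟧-⇉ (papp a b m n) =
    𝐚𝐩𝐩-cong* (⟦⟧-⇉ a) (dlam-cong* (𝐄𝐥-cong* (⟦⟧-⇉ a)) (⟦⟧-⇉ b)) (⟦⟧-⇉ m) (⟦⟧-⇉ n)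
  ⟦⟧-⇉ (pβ {M′ = M′} {N′ = N′} r m n) =
    𝐚𝐩𝐩-cong* ε ε (𝐚𝐛𝐬-cong* ε ε (dlam-cong* ε (⟦⟧-⇉ m))) (⟦⟧-⇉ n) ◅◅
    r-app r ◅ dβ≡ (sym (⟦⟧-[] M′ N′)) ◅ ε

  ⟦⟧-≡E : ∀ {n} {M N : Term n} → M ≡E N → ⟦ M ⟧ ≡D ⟦ N ⟧
  ⟦⟧-≡E = kleisliStar ⟦_⟧ λ { (fwd r) → a—↠b⇒a↔b (⟦⟧-⇉ (⟶⇒⇉ r))
                            ; (bwd r) → a—↠b⇒b↔a (⟦⟧-⇉ (⟶⇒⇉ r)) }

  -- Soundness of the translation

  lookup-typed : ∀ {n} {Γ : Ctx n} (wf : WF Γ) i →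
                 Σ Sort λ s → Γ ⊢ lookup Γ i ∶ sort s × dlookup ⟦ wf ⟧ctx i ≡ 𝐄𝐥 s ⟦ lookup Γ i ⟧
  lookup-typed (wf-▸ {A = A} wf s a) zero =
    s , ⊢-wk a (wf-▸ wf s a) , cong (𝐄𝐥 s) (sym (⟦⟧-ren suc A))
  lookup-typed {Γ = Γ ▸ _} (wf-▸ wf s a) (suc i) with lookup-typed wf i
  ... | s′ , t , e = s′ , ⊢-wk t (wf-▸ wf s a) ,
                     trans (cong dwk e) (cong (𝐄𝐥 s′) (sym (⟦⟧-ren suc (lookup Γ i))))

  type-validity : ∀ {n} {Γ : Ctx n} {M T} → Γ ⊢ M ∶ T →
                  (Σ Sort λ s → Γ ⊢ T ∶ sort s) ⊎ (Σ Sort λ s → T ≡ sort s)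
  type-validity (t-conv _ b _)    = inj₁ (_ , b)
  type-validity (t-sort _ _)      = inj₂ (_ , refl)
  type-validity (t-var {i = i} w) = inj₁ (_ , proj₁ (proj₂ (lookup-typed w i)))
  type-validity (t-prod _ _ _)    = inj₂ (_ , refl)
  type-validity (t-abs r a b _)   = inj₁ (_ , t-prod r a b)
  type-validity (t-app r a b n _) = inj₁ (_ , ⊢-[] b n)

  sort-typed⇒Ax : ∀ {n} {Γ : Ctx n} {s s′} → Γ ⊢ sort s ∶ sort s′ → Ax s s′
  sort-typed⇒Ax d with gen-sort d
  ... | _ , ax , p with sort-≡E-inj p
  ... | refl = ax

  ≡E-sort-typed⇒Ax : ∀ {n} {Γ : Ctx n} {B s t} → Γ ⊢ B ∶ sort s → sort t ≡E B → Ax t s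
  ≡E-sort-typed⇒Ax b e with church-rosser ⟶-confluent e
  ... | _ , p , q with sort-⟶*-inv p
  ... | refl = sort-typed⇒Ax (⊢-⟶* b q)

  -- Both readings are carried because a conversion may turn a sort into a type that is not one.
  record Sound {n} {Γ : Ctx n} (wf : WF Γ) (M A : Term n) : Set where
    field
      𝐔-typed  : ∀ {s} → A ≡ sort s → ⟦ wf ⟧ctx ⊢D ⟦ M ⟧ ∶ 𝐔 s
      𝐄𝐥-typed : ∀ {s} → Γ ⊢ A ∶ sort s → ⟦ wf ⟧ctx ⊢D ⟦ M ⟧ ∶ 𝐄𝐥 s ⟦ A ⟧
  open Sound public

  sound-𝐔 : ∀ {n} {Γ : Ctx n} {wf : WF Γ} {M s} → DWF ⟦ wf ⟧ctx →
            ⟦ wf ⟧ctx ⊢D ⟦ M ⟧ ∶ 𝐔 s → Sound wf M (sort s)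
  sound-𝐔 w d .𝐔-typed refl = d
  sound-𝐔 w d .𝐄𝐥-typed t   = d-conv type d (c-El w (c-u w ax)) (bwd (r-El ax) ◅ ε)
    where ax = sort-typed⇒Ax t

  sound-𝐄𝐥 : ∀ {n} {Γ : Ctx n} {wf : WF Γ} {M A s} → DWF ⟦ wf ⟧ctx → Γ ⊢ A ∶ sort s →
             ⟦ wf ⟧ctx ⊢D ⟦ M ⟧ ∶ 𝐄𝐥 s ⟦ A ⟧ → Sound wf M A
  sound-𝐄𝐥 w a d .𝐔-typed refl = d-conv type d (c-U w) (fwd (r-El (sort-typed⇒Ax a)) ◅ ε)
  sound-𝐄𝐥 w a d .𝐄𝐥-typed a′  = subst (λ s → _ ⊢D _ ∶ 𝐄𝐥 s _) (⊢-sort-unique a a′) d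

  ⊢D-family : ∀ {n} {Δ : DCtx n} {s₁ s₂ A B} → DWF Δ → Δ ⊢D A ∶ 𝐔 s₁ →
              Δ ▹ 𝐄𝐥 s₁ A ⊢D B ∶ 𝐔 s₂ → Δ ⊢D dlam (𝐄𝐥 s₁ A) B ∶ (𝐄𝐥 s₁ A ⇒ 𝐔 s₂)
  ⊢D-family w a b = d-lam type (c-El w a) (c-U (dwf-▹ w (c-El w a))) b

  ⊢D-family-body : ∀ {n} {Δ : DCtx n} {s₁ s₂ A B M} → DWF Δ → Δ ⊢D A ∶ 𝐔 s₁ →
                   Δ ▹ 𝐄𝐥 s₁ A ⊢D B ∶ 𝐔 s₂ → Δ ⊢D M ∶ dpi (𝐄𝐥 s₁ A) (𝐄𝐥 s₂ B) →
                   Δ ⊢D M ∶ dpi (𝐄𝐥 s₁ A) (𝐄𝐥 s₂ (dwk (dlam (𝐄𝐥 s₁ A) B) · dvar zero))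
  ⊢D-family-body {B = B} w a b m =
    d-conv type m (d-pi type (c-El w a) (c-El w′ (d-app (⊢D-wk (⊢D-family w a b) w′) (d-var w′))))
           (bwd (dpi₂ (El₁ (dβ≡ (dren-extR-suc-⟨dvar0⟩ B)))) ◅ ε)
    where w′ = dwf-▹ w (c-El w a)

  ⟦⟧-sound : ∀ {n} {Γ : Ctx n} (wf : WF Γ) → DWF ⟦ wf ⟧ctx → ∀ {M A} → Γ ⊢ M ∶ A → Sound wf M A
  ⟦⟧-sound wf w (t-sort _ ax) = sound-𝐔 w (c-u w ax)
  ⟦⟧-sound wf w (t-var {i = i} _) with lookup-typed wf i
  ... | _ , t , e = sound-𝐄𝐥 w t (dretype e (d-var w))
  ⟦⟧-sound wf w (t-prod r a b) = sound-𝐔 w (c-Prod w r ⊢A (⊢D-family w ⊢A ⊢B))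
    where ⊢A = 𝐔-typed (⟦⟧-sound wf w a) refl
          ⊢B = 𝐔-typed (⟦⟧-sound (wf-▸ wf _ a) (dwf-▹ w (c-El w ⊢A)) b) refl
  ⟦⟧-sound wf w (t-abs r a b m) =
    sound-𝐄𝐥 w (t-prod r a b)
      (c-abs w r ⊢A (⊢D-family w ⊢A ⊢B) (⊢D-family-body w ⊢A ⊢B ⊢λM))
    where ⊢A  = 𝐔-typed (⟦⟧-sound wf w a) refl
          w′  = dwf-▹ w (c-El w ⊢A)
          ⊢B  = 𝐔-typed (⟦⟧-sound (wf-▸ wf _ a) w′ b) refl
          ⊢λM = d-lam type (c-El w ⊢A) (c-El w′ ⊢B) (𝐄𝐥-typed (⟦⟧-sound (wf-▸ wf _ a) w′ m) b)
  ⟦⟧-sound wf w (t-app {B = B} {N = N} r a b n m) =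
    sound-𝐄𝐥 w (⊢-[] b n) (d-conv type (c-app w r ⊢A (⊢D-family w ⊢A ⊢B) ⊢M ⊢N) (c-El w ⊢B[N])
                                  (fwd (El₁ (dβ≡ (sym (⟦⟧-[] B N)))) ◅ ε))
    where ⊢A = 𝐔-typed (⟦⟧-sound wf w a) refl
          ⊢B = 𝐔-typed (⟦⟧-sound (wf-▸ wf _ a) (dwf-▹ w (c-El w ⊢A)) b) refl
          ⊢M = 𝐄𝐥-typed (⟦⟧-sound wf w m) (t-prod r a b)
          ⊢N = 𝐄𝐥-typed (⟦⟧-sound wf w n) a
          ⊢B[N] = subst (λ X → _ ⊢D X ∶ 𝐔 _) (sym (⟦⟧-[] B N)) (⊢D-⟨⟩ w ⊢B ⊢N)
  ⟦⟧-sound wf w (t-conv {M = M} {A = A′} {B = B} {s = s} d b e) =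
    sound-𝐄𝐥 w b (converted (type-validity d))
    where
      ⊢B = 𝐔-typed (⟦⟧-sound wf w b) refl
      ⟦e⟧ = EqClosure.gmap (𝐄𝐥 s) El₁ (⟦⟧-≡E e)
      converted : (Σ Sort λ s′ → _ ⊢ A′ ∶ sort s′) ⊎ (Σ Sort λ t → A′ ≡ sort t) →
                  ⟦ wf ⟧ctx ⊢D ⟦ M ⟧ ∶ 𝐄𝐥 s ⟦ B ⟧
      converted (inj₁ (_ , a′)) with ≡E-sort-unique a′ b e
      ... | refl = d-conv type (𝐄𝐥-typed (⟦⟧-sound wf w d) a′) (c-El w ⊢B) ⟦e⟧
      converted (inj₂ (_ , refl)) =
        d-conv type (𝐔-typed (⟦⟧-sound wf w d) refl) (c-El w ⊢B)
               (bwd (r-El (≡E-sort-typed⇒Ax b e)) ◅ ⟦e⟧)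

  ⟦⟧ctx-wf : ∀ {n} {Γ : Ctx n} (wf : WF Γ) → DWF ⟦ wf ⟧ctx
  ⟦⟧ctx-wf wf-∅          = dwf-∅
  ⟦⟧ctx-wf (wf-▸ wf s a) = dwf-▹ w (c-El w (𝐔-typed (⟦⟧-sound wf w a) refl))
    where w = ⟦⟧ctx-wf wf

mainTheorem2 : (Sp : Spec) → let open Theory Sp in
    ((n : ℕ) (Γ : Ctx n) (wf : WF Γ) → DWF ⟦ wf ⟧ctx)
    ×
    ((n : ℕ) (Γ : Ctx n) (wf : WF Γ) (M A : Term n) → Γ ⊢ M ∶ A →
      ((s : Spec.Sort Sp) → A ≡ sort s → (∀ s′ → ¬ Spec.Ax Sp s s′) → ⟦ wf ⟧ctx ⊢D ⟦ M ⟧ ∶ 𝐔 s)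
      ×
      (¬ IsTopSort A → (sA : Spec.Sort Sp) → Γ ⊢ A ∶ sort sA →
        ⟦ wf ⟧ctx ⊢D ⟦ M ⟧ ∶ 𝐄𝐥 sA ⟦ A ⟧))
mainTheorem2 Sp =
  (λ _ _ wf → ⟦⟧ctx-wf wf) ,
  λ _ _ wf _ _ d → let sound = ⟦⟧-sound wf (⟦⟧ctx-wf wf) d in
    (λ _ A≡s _ → 𝐔-typed sound A≡s) , (λ _ _ a → 𝐄𝐥-typed sound a)
  where open Metatheory Sp
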